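{- Let $n,k$ be integers with $k\ge 3$ and $k\le n-1$, let $a_0,\dots,a_k$ be nonzero integers each of whose prime factors is $\le k$, and let \[ f(x)=\sum_{j=0}^{k} a_j c_j x^j,\qquad c_j=\binom{n}{j}\binom{n-j-1}{k-j}(-1)^{k-j}. \] Let $n'$ be the largest divisor of $n(n-k)$ relatively prime to $k!$, write $n'=p_1^{e_1}\cdots p_r^{e_r}$ with distinct primes $p_i$ and positive integers $e_i$, and suppose $\gcd(k,e_1,\dots,e_r)=2$. Let $n''$ be the largest divisor of $(n-1)(n-k+1)$ that is relatively prime to $k!$. Suppose $p$ is a prime with $p>k$ and $\nu_p(n'')=e$ for a positive integer $e$. If $f(x)$ is reducible over $\mathbb{Q}$, then $(k-1)\mid e$.
   Context: For a prime $p$ and nonzero integer $m$, $\nu_p(m)$ denotes the exponent $r$ with $p^r\mid m$, $p^{r+1}\nmid m$. -}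

module Defs where

open import Data.Nat as ℕ using (ℕ; zero; suc; _∸_; _≤_; _<_; _!; _^_)
open import Data.Nat.Divisibility using (_∣_)
open import Data.Nat.Combinatorics using (_C_)
open import Data.Integer as ℤ using (ℤ; +_)
open import Data.Rational as ℚ using (ℚ; 0ℚ)
open import Data.Product using (Σ; _×_; ∃)
open import Data.List using (List; []; _∷_; foldr; map)
open import Data.Nat.GCD using (gcd)
open import Relation.Nullary using (¬_)
open import Relation.Binary.PropositionalEquality using (_≡_; _≢_)

HasValuation : ℕ → ℕ → ℕ → Set
HasValuation p m r = (p ^ r) ∣ m × ¬ ((p ^ suc r) ∣ m)

IsLargestCoprimeDivisor : ℕ → ℕ → ℕ → Set
IsLargestCoprimeDivisor d N M =
  d ∣ N × Data.Nat.Coprimality.Coprime d M ×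
  (∀ d' → d' ∣ N → Data.Nat.Coprimality.Coprime d' M → d' ≤ d)
  where import Data.Nat.Coprimality

factorProduct : List (ℕ × ℕ) → ℕ
factorProduct [] = 1
factorProduct ((p Data.Product., e) ∷ ps) = p ^ e ℕ.* factorProduct ps

gcdWithExps : ℕ → List (ℕ × ℕ) → ℕ
gcdWithExps k ps = foldr gcd k (map Data.Product.proj₂ ps)

sgn : ℕ → ℤ
sgn zero = + 1
sgn (suc m) = ℤ.- sgn m

cCoeff : ℕ → ℕ → ℕ → ℤ
cCoeff n k j = (+ ((n C j) ℕ.* ((n ∸ j ∸ 1) C (k ∸ j)))) ℤ.* sgn (k ∸ j)

-- polynomials over ℚ as coefficient sequences ℕ → ℚ
-- g has degree exactly d
HasDegree : (ℕ → ℚ) → ℕ → Set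
HasDegree g d = g d ≢ 0ℚ × (∀ i → d < i → g i ≡ 0ℚ)

convAux : (ℕ → ℚ) → (ℕ → ℚ) → ℕ → ℕ → ℚ
convAux g h m zero = 0ℚ
convAux g h m (suc t) = convAux g h m t ℚ.+ g t ℚ.* h (m ∸ t)

polyMulCoeff : (ℕ → ℚ) → (ℕ → ℚ) → ℕ → ℚ
polyMulCoeff g h m = convAux g h m (suc m)

ReducibleOverℚ : (ℕ → ℚ) → Set
ReducibleOverℚ f =
  Σ (ℕ → ℚ) λ g → Σ (ℕ → ℚ) λ h → Σ ℕ λ d → Σ ℕ λ e →
    1 ≤ d × 1 ≤ e × HasDegree g d × HasDegree h e ×
    (∀ m → f m ≡ polyMulCoeff g h m)

fPoly : ℕ → ℕ → (ℕ → ℤ) → ℕ → ℚ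
fPoly n k a j with j ℕ.≤? k
... | Relation.Nullary.yes _ = ℚ._/_ (a j ℤ.* cCoeff n k j) 1
... | Relation.Nullary.no _ = 0ℚ

-- Fix a prime q > k and write n = s + k + 1. Up to sign and factors prime to q, a_j c_j (n − j) is the
-- product (s + 1)(s + 2)⋯n of k + 1 consecutive integers, at most one of which, t, is divisible by q.
-- So ν_q(a_j c_j) = ν_q(t) for every j ≤ k except j = n − t, where it is 0, and the Newton polygon of f
-- at q is a single edge of length ℓ from n − t to an end of [0, k]. By Dumas's theorem a factorisation
-- f = g·h splits this edge into edges of g and h of the same slope ν_q(t) / ℓ, and since their endpoints
-- are lattice points, ℓ divides ν_q(t) times their lengths.
-- The primes of n(n − k) give ℓ = k and pieces of lengths d and k − d, so k ∣ d·e_i for all i, whence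
-- k ∣ d·gcd(k, e_1, …, e_r) = 2d and k = 2d. The prime p of (n − 1)(n − k + 1) gives ℓ = k − 1 split
-- into lengths d and d − 1, so k − 1 divides e·d and e·(d − 1), hence e.

module Submission where

open import Data.Bool using (true)
open import Data.Empty using (⊥-elim)
import Data.Integer
open import Data.Integer as ℤ using (ℤ; +_; 0ℤ; ∣_∣)
import Data.Integer.Divisibility.Signed as ℤ∣
import Data.Integer.Properties as ℤ
open import Data.Integer.Tactic.RingSolver using (solve-∀)
open import Data.List using (List; []; _∷_; map; foldr)
open import Data.List.Relation.Unary.All as All using (All; []; _∷_)
import Data.List.Relation.Unary.All.Properties as All
open import Data.List.Relation.Unary.AllPairs using ([]; _∷_)
open import Data.List.Relation.Unary.Unique.Propositional using (Unique)
open import Data.Nat as ℕ using (ℕ; zero; suc; _+_; _*_; _∸_; _^_; _≤_; _<_; z≤n; s≤s; _!; NonZero; >-nonZero)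
open import Data.Nat.Combinatorics using (_C_; _P_; nCk≡nPk/k!)
open import Data.Nat.Combinatorics.Base using (_P′_)
open import Data.Nat.Combinatorics.Specification using (k!∣nP′k)
open import Data.Nat.Coprimality using (Coprime; coprime-divisor)
open import Data.Nat.Divisibility
open import Data.Nat.DivMod using (/-congˡ; m*n/n≡m)
open import Data.Nat.GCD using (gcd; gcd-greatest; c*gcd[m,n]≡gcd[cm,cn])
open import Data.Nat.LCM using (lcm; m∣lcm[m,n]; n∣lcm[m,n]; lcm-least)
open import Data.Nat.Primality
  using (Prime; prime[2]; prime⇒nonZero; prime⇒nonTrivial; prime⇒irreducible; euclidsLemma)
open import Data.Nat.Properties
open import Algebra.Properties.CommutativeSemigroup *-commutativeSemigroup using (x∙yz≈y∙xz)
import Data.Nat.Tactic.RingSolver as ℕ-Solver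
open import Data.Product using (∃-syntax; _×_; _,_; proj₁; proj₂)
import Data.Product as Product
open import Data.Rational as ℚ using (ℚ; 0ℚ; toℚᵘ)
import Data.Rational.Properties as ℚ
import Data.Rational.Unnormalised as ℚᵘ
open import Data.Sum using (_⊎_; inj₁; inj₂)
import Data.Sum as Sum
open import Function using (_∘_)
open import Relation.Binary.Definitions using (tri<; tri≈; tri>)
open import Relation.Binary.PropositionalEquality
open import Relation.Nullary using (¬_; Dec; yes; no)

open import Defs

diff-≡ : ∀ a b c d → a + d ≡ c + b → + a ℤ.- + b ≡ + c ℤ.- + d
diff-≡ a b c d a+d≡c+b = begin
  + a ℤ.- + b            ≡⟨ ℤ.[+m]-[+n]≡m⊖n a b ⟩
  a ℤ.⊖ b                ≡⟨ ℤ.+-cancelˡ-⊖ d a b ⟨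
  (d + a) ℤ.⊖ (d + b)    ≡⟨ cong₂ ℤ._⊖_ (trans (+-comm d a) (trans a+d≡c+b (+-comm c b))) (+-comm d b) ⟩
  (b + c) ℤ.⊖ (b + d)    ≡⟨ ℤ.+-cancelˡ-⊖ b c d ⟩
  c ℤ.⊖ d                ≡⟨ ℤ.[+m]-[+n]≡m⊖n c d ⟨
  + c ℤ.- + d            ∎
  where open ≡-Reasoning

diff-≤ : ∀ a b c d → a + d ≤ c + b → + a ℤ.- + b ℤ.≤ + c ℤ.- + d
diff-≤ a b c d a+d≤c+b = begin
  + a ℤ.- + b
    ≡⟨ diff-≡ a b (a + d) (b + d) (trans (cong (a ℕ.+_) (+-comm b d)) (sym (+-assoc a d b))) ⟩
  + (a + d) ℤ.- + (b + d)        ≤⟨ ℤ.+-monoˡ-≤ (ℤ.- + (b + d)) (ℤ.+≤+ a+d≤c+b) ⟩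
  + (c + b) ℤ.- + (b + d)        ≡⟨ diff-≡ (c + b) (b + d) c d (+-assoc c b d) ⟩
  + c ℤ.- + d                    ∎
  where open ℤ.≤-Reasoning

diff-cancel-< : ∀ {a b} c → + a ℤ.- + c ℤ.< + b ℤ.- + c → a < b
diff-cancel-< {a} {b} c a-c<b-c = ≰⇒> (λ b≤a → ℤ.<⇒≱ a-c<b-c (diff-≤ b c a c (+-monoˡ-≤ c b≤a)))

∣∣>0 : ∀ {z} → z ≢ 0ℤ → 0 < ∣ z ∣
∣∣>0 z≢0 = n≢0⇒n>0 (λ ∣z∣≡0 → z≢0 (ℤ.∣i∣≡0⇒i≡0 ∣z∣≡0))

*≢0 : ∀ {x y} → x ≢ 0ℤ → y ≢ 0ℤ → x ℤ.* y ≢ 0ℤ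
*≢0 {x} x≢0 y≢0 xy≡0 = Sum.[ x≢0 , y≢0 ] (ℤ.i*j≡0⇒i≡0∨j≡0 x xy≡0)

∣m∣m+n⇒≤n : ∀ {d m n} → d ∣ m → d ∣ m + n → 0 < n → d ≤ n
∣m∣m+n⇒≤n d∣m d∣m+n 0<n = ∣⇒≤ {{>-nonZero 0<n}} (∣m+n∣m⇒∣n d∣m+n d∣m)

+<+⇒<⊎< : ∀ {i j a b} → i + j < a + b → i < a ⊎ j < b
+<+⇒<⊎< {i} {j} {a} {b} i+j<a+b with i <? a
... | yes i<a = inj₁ i<a
... | no  i≮a = inj₂ (≰⇒> (λ b≤j → <⇒≱ i+j<a+b (+-mono-≤ (≮⇒≥ i≮a) b≤j)))

+≡+⇒<⊎< : ∀ {i j a b} → i + j ≡ a + b → i ≢ a → i < a ⊎ j < b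
+≡+⇒<⊎< {i} {j} {a} {b} i+j≡a+b i≢a with <-cmp i a
... | tri< i<a _ _ = inj₁ i<a
... | tri≈ _ i≡a _ = ⊥-elim (i≢a i≡a)
... | tri> _ _ a<i = inj₂ (+-cancelˡ-< a j b (<-≤-trans (+-monoˡ-< j a<i) (≤-reflexive i+j≡a+b)))

≢0⇒↥≢0 : ∀ {x} → x ≢ 0ℚ → ℚ.↥ x ≢ 0ℤ
≢0⇒↥≢0 {x} x≢0 ↥x≡0 = x≢0 (ℚ.↥p≡0⇒p≡0 x ↥x≡0)

≃⇒↥≢0 : ∀ x u → toℚᵘ x ℚᵘ.≃ u → ℚᵘ.↥ u ≢ 0ℤ → ℚ.↥ x ≢ 0ℤ
≃⇒↥≢0 (ℚ.mkℚ a b _) (ℚᵘ.mkℚᵘ c d) (ℚᵘ.*≡* eq) c≢0 a≡0 =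
  *≢0 c≢0 (λ ()) (trans (sym eq) (cong (ℤ._* + suc d) a≡0))

≃⇒≢0 : ∀ x u → toℚᵘ x ℚᵘ.≃ u → ℚᵘ.↥ u ≢ 0ℤ → x ≢ 0ℚ
≃⇒≢0 x u x≃u ↥u≢0 x≡0 = ≃⇒↥≢0 x u x≃u ↥u≢0 (ℚ.p≡0⇒↥p≡0 x x≡0)

≃∧≢0⇒↥ᵘ≢0 : ∀ x u → toℚᵘ x ℚᵘ.≃ u → x ≢ 0ℚ → ℚᵘ.↥ u ≢ 0ℤ
≃∧≢0⇒↥ᵘ≢0 (ℚ.mkℚ a b _) (ℚᵘ.mkℚᵘ c d) (ℚᵘ.*≡* eq) a/b≢0 c≡0 =
  *≢0 (≢0⇒↥≢0 a/b≢0) (λ ()) (trans eq (cong (ℤ._* + suc b) c≡0))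

/1≢0 : ∀ {z} → z ≢ 0ℤ → z ℚ./ 1 ≢ 0ℚ
/1≢0 {z} = ≃⇒≢0 (z ℚ./ 1) (ℚᵘ.mkℚᵘ z 0) (ℚ.toℚᵘ-fromℚᵘ (ℚᵘ.mkℚᵘ z 0))

module Valuation {p : ℕ} (p-prime : Prime p) where

  instance
    p≢0 : NonZero p
    p≢0 = prime⇒nonZero p-prime

  1<p : 1 < p
  1<p = ℕ.nonTrivial⇒n>1 p {{prime⇒nonTrivial p-prime}}

  p∤1 : ¬ p ∣ 1
  p∤1 = >⇒∤ 1<p

  p∤⇒0< : ∀ {m} → ¬ p ∣ m → 0 < m
  p∤⇒0< {zero}  p∤0 = ⊥-elim (p∤0 (p ∣0))
  p∤⇒0< {suc m} _   = s≤s z≤n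

  p∤* : ∀ {m n} → ¬ p ∣ m → ¬ p ∣ n → ¬ p ∣ m * n
  p∤* {m} {n} p∤m p∤n p∣mn with euclidsLemma m n p-prime p∣mn
  ... | inj₁ p∣m = p∤m p∣m
  ... | inj₂ p∣n = p∤n p∣n

  Split : ℕ → ℕ → Set
  Split m r = ∃[ u ] m ≡ p ^ r * u × ¬ p ∣ u

  private
    ν-fuel : ℕ → ℕ → ℕ
    ν-fuel zero       m = 0
    ν-fuel (suc fuel) m with p ∣? m
    ... | yes (divides q _) = suc (ν-fuel fuel q)
    ... | no _              = 0

    ν-fuel-split : ∀ fuel m → 0 < m → m ≤ fuel → Split m (ν-fuel fuel m)
    ν-fuel-split zero       m 0<m m≤0 = ⊥-elim (<⇒≱ 0<m m≤0)
    ν-fuel-split (suc fuel) m 0<m m≤fuel with p ∣? m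
    ... | no p∤m = m , sym (*-identityˡ m) , p∤m
    ... | yes (divides q m≡q*p) =
      let u , q≡ , p∤u = ν-fuel-split fuel q 0<q (≤-pred (≤-trans q<m m≤fuel))
      in u , (begin
        m                               ≡⟨ m≡q*p ⟩
        q * p                           ≡⟨ cong (_* p) q≡ ⟩
        p ^ ν-fuel fuel q * u * p       ≡⟨ *-comm _ p ⟩
        p * (p ^ ν-fuel fuel q * u)     ≡⟨ *-assoc p _ u ⟨
        p ^ suc (ν-fuel fuel q) * u     ∎) , p∤u
      where
      open ≡-Reasoning
      0<q : 0 < q
      0<q = n≢0⇒n>0 (λ { refl → <⇒≢ 0<m (sym m≡q*p) })
      q<m : q < m
      q<m = subst (q <_) (sym m≡q*p) (m<m*n q p {{>-nonZero 0<q}} 1<p)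

  opaque
    ν : ℕ → ℕ
    ν m = ν-fuel m m

    ν-split : ∀ {m} → 0 < m → Split m (ν m)
    ν-split {m} 0<m = ν-fuel-split m m 0<m ≤-refl

  split-unique : ∀ {r s u w} → p ^ r * u ≡ p ^ s * w → ¬ p ∣ u → ¬ p ∣ w → r ≡ s
  split-unique {zero}  {zero}  _  _   _   = refl
  split-unique {zero}  {suc s} {u} {w} eq p∤u _ =
    ⊥-elim (p∤u (divides (p ^ s * w) (trans (trans (sym (+-identityʳ u)) eq)
      (trans (*-assoc p (p ^ s) w) (*-comm p _)))))
  split-unique {suc r} {zero}  {u} {w} eq _ p∤w =
    ⊥-elim (p∤w (divides (p ^ r * u) (trans (trans (sym (+-identityʳ w)) (sym eq))
      (trans (*-assoc p (p ^ r) u) (*-comm p _)))))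
  split-unique {suc r} {suc s} {u} {w} eq p∤u p∤w = cong suc (split-unique
    (*-cancelˡ-≡ _ _ p (trans (sym (*-assoc p (p ^ r) u)) (trans eq (*-assoc p (p ^ s) w))))
    p∤u p∤w)

  ν-unique : ∀ {m r u} → m ≡ p ^ r * u → ¬ p ∣ u → ν m ≡ r
  ν-unique {m} {r} eq p∤u =
    let w , m≡ , p∤w = ν-split 0<m in split-unique (trans (sym m≡) eq) p∤w p∤u
    where
    0<m : 0 < m
    0<m = subst (0 <_) (sym eq) (*-mono-≤ (m^n>0 p r) (p∤⇒0< p∤u))

  ν-p∤ : ∀ {m} → ¬ p ∣ m → ν m ≡ 0
  ν-p∤ {m} p∤m = ν-unique (sym (*-identityˡ m)) p∤m

  ν-* : ∀ {m n} → 0 < m → 0 < n → ν (m * n) ≡ ν m + ν n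
  ν-* {m} {n} 0<m 0<n = ν-unique eq (p∤* p∤u p∤w)
    where
    open ≡-Reasoning
    u = proj₁ (ν-split 0<m)
    w = proj₁ (ν-split 0<n)
    m≡ = proj₁ (proj₂ (ν-split 0<m))
    n≡ = proj₁ (proj₂ (ν-split 0<n))
    p∤u = proj₂ (proj₂ (ν-split 0<m))
    p∤w = proj₂ (proj₂ (ν-split 0<n))
    eq : m * n ≡ p ^ (ν m + ν n) * (u * w)
    eq = begin
      m * n                                 ≡⟨ cong₂ _*_ m≡ n≡ ⟩
      (p ^ ν m * u) * (p ^ ν n * w)         ≡⟨ *-assoc (p ^ ν m) u _ ⟩
      p ^ ν m * (u * (p ^ ν n * w))         ≡⟨ cong (p ^ ν m *_) (x∙yz≈y∙xz u (p ^ ν n) w) ⟩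
      p ^ ν m * (p ^ ν n * (u * w))         ≡⟨ *-assoc (p ^ ν m) _ _ ⟨
      p ^ ν m * p ^ ν n * (u * w)           ≡⟨ cong (_* (u * w)) (^-distribˡ-+-* p (ν m) (ν n)) ⟨
      p ^ (ν m + ν n) * (u * w)             ∎

  ^∣-mono : ∀ {r s} → r ≤ s → p ^ r ∣ p ^ s
  ^∣-mono {r} {s} r≤s =
    subst (p ^ r ∣_) (trans (sym (^-distribˡ-+-* p r (s ∸ r))) (cong (p ^_) (m+[n∸m]≡n r≤s)))
      (m∣m*n (p ^ (s ∸ r)))

  ≤ν⇒^∣ : ∀ {m r} → 0 < m → r ≤ ν m → p ^ r ∣ m
  ≤ν⇒^∣ 0<m r≤ν =
    let u , m≡ , _ = ν-split 0<m in subst (_ ∣_) (sym m≡) (∣m⇒∣m*n u (^∣-mono r≤ν))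

  ^∣⇒≤ν : ∀ {m r} → 0 < m → p ^ r ∣ m → r ≤ ν m
  ^∣⇒≤ν {m} {r} 0<m p^r∣m with r ≤? ν m
  ... | yes r≤ν = r≤ν
  ... | no  r≰ν = ⊥-elim (p∤u (*-cancelˡ-∣ (p ^ ν m) {{m^n≢0 p (ν m)}} p^ν*p∣p^ν*u))
    where
    u = proj₁ (ν-split 0<m)
    p∤u = proj₂ (proj₂ (ν-split 0<m))
    p^ν*p∣p^ν*u : p ^ ν m * p ∣ p ^ ν m * u
    p^ν*p∣p^ν*u = subst₂ _∣_ (*-comm p _) (proj₁ (proj₂ (ν-split 0<m)))
      (∣-trans (^∣-mono (≰⇒> r≰ν)) p^r∣m)

  0<ν⇒∣ : ∀ {m} → 0 < m → 0 < ν m → p ∣ m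
  0<ν⇒∣ 0<m 0<ν = subst (_∣ _) (*-identityʳ p) (≤ν⇒^∣ 0<m 0<ν)

  hasValuation⇒ν : ∀ {m r} → HasValuation p m r → ν m ≡ r
  hasValuation⇒ν {m} {r} (divides u m≡u*p^r , p^1+r∤m) =
    ν-unique (trans m≡u*p^r (*-comm u _)) p∤u
    where
    p∤u : ¬ p ∣ u
    p∤u (divides v u≡v*p) = p^1+r∤m (divides v (begin
      m             ≡⟨ m≡u*p^r ⟩
      u * p ^ r     ≡⟨ cong (_* p ^ r) u≡v*p ⟩
      v * p * p ^ r ≡⟨ *-assoc v p _ ⟩
      v * p ^ suc r ∎))
      where open ≡-Reasoning

  νℤ : ℤ → ℕ
  νℤ z = ν ∣ z ∣

  νℤ-* : ∀ {x y} → x ≢ 0ℤ → y ≢ 0ℤ → νℤ (x ℤ.* y) ≡ νℤ x + νℤ y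
  νℤ-* {x} {y} x≢0 y≢0 = trans (cong ν (ℤ.abs-* x y)) (ν-* (∣∣>0 x≢0) (∣∣>0 y≢0))

  private
    ^∣ℤ : ∀ {r z} → z ≢ 0ℤ → r ≤ νℤ z → + (p ^ r) ℤ∣.∣ z
    ^∣ℤ z≢0 r≤νz = ℤ∣.∣ᵤ⇒∣ (≤ν⇒^∣ (∣∣>0 z≢0) r≤νz)

    ^∣ℤ⇒≤ : ∀ {r z} → z ≢ 0ℤ → + (p ^ r) ℤ∣.∣ z → r ≤ νℤ z
    ^∣ℤ⇒≤ {r} {z} z≢0 p^r∣z = ^∣⇒≤ν (∣∣>0 z≢0) (ℤ∣.∣⇒∣ᵤ {+ (p ^ r)} {z} p^r∣z)

  νℤ-ultrametric : ∀ {x y} → x ≢ 0ℤ → y ≢ 0ℤ → x ℤ.+ y ≢ 0ℤ →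
                   νℤ x ≤ νℤ (x ℤ.+ y) ⊎ νℤ y ≤ νℤ (x ℤ.+ y)
  νℤ-ultrametric {x} {y} x≢0 y≢0 x+y≢0 with ≤-total (νℤ x) (νℤ y)
  ... | inj₁ x≤y = inj₁ (^∣ℤ⇒≤ x+y≢0 (ℤ∣.∣m∣n⇒∣m+n (^∣ℤ x≢0 ≤-refl) (^∣ℤ y≢0 x≤y)))
  ... | inj₂ y≤x = inj₂ (^∣ℤ⇒≤ x+y≢0 (ℤ∣.∣m∣n⇒∣m+n (^∣ℤ x≢0 y≤x) (^∣ℤ y≢0 ≤-refl)))

  νℤ-+-dominant : ∀ {x y} → x ≢ 0ℤ → y ≢ 0ℤ → νℤ x < νℤ y →
                  x ℤ.+ y ≢ 0ℤ × νℤ (x ℤ.+ y) ≡ νℤ x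
  νℤ-+-dominant {x} {y} x≢0 y≢0 x<y = x+y≢0 , hasValuation⇒ν
    (ℤ∣.∣⇒∣ᵤ (ℤ∣.∣m∣n⇒∣m+n (^∣ℤ x≢0 ≤-refl) (^∣ℤ y≢0 (<⇒≤ x<y))) , p^1+νx∤x+y)
    where
    p^1+νx∤x+y : ¬ p ^ suc (νℤ x) ∣ ∣ x ℤ.+ y ∣
    p^1+νx∤x+y p∣x+y = <-irrefl refl (^∣ℤ⇒≤ x≢0
      (ℤ∣.∣m+n∣n⇒∣m (ℤ∣.∣ᵤ⇒∣ p∣x+y) (^∣ℤ y≢0 x<y)))
    x+y≢0 : x ℤ.+ y ≢ 0ℤ
    x+y≢0 x+y≡0 = p^1+νx∤x+y (subst (λ z → _ ∣ ∣ z ∣) (sym x+y≡0) (_ ∣0))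

  -- ν 0 = 0 is a junk value: lemmas about ν, νℤ and vℚ assume nonzero arguments.
  vℚ : ℚ → ℤ
  vℚ x = + νℤ (ℚ.↥ x) ℤ.- + ν (ℚ.↧ₙ x)

  vᵘ : ℚᵘ.ℚᵘ → ℤ
  vᵘ u = + νℤ (ℚᵘ.↥ u) ℤ.- + ν (ℚᵘ.↧ₙ u)

  private
    vℚ-≃ : ∀ x u → toℚᵘ x ℚᵘ.≃ u → ℚᵘ.↥ u ≢ 0ℤ → vℚ x ≡ vᵘ u
    vℚ-≃ x@(ℚ.mkℚ a b _) u@(ℚᵘ.mkℚᵘ c d) x≃u@(ℚᵘ.*≡* eq) c≢0 =
      diff-≡ (νℤ a) (ν (suc b)) (νℤ c) (ν (suc d)) (begin
        νℤ a + ν (suc d)       ≡⟨ νℤ-* (≃⇒↥≢0 x u x≃u c≢0) (λ ()) ⟨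
        νℤ (a ℤ.* + suc d)     ≡⟨ cong νℤ eq ⟩
        νℤ (c ℤ.* + suc b)     ≡⟨ νℤ-* c≢0 (λ ()) ⟩
        νℤ c + ν (suc b)       ∎)
      where open ≡-Reasoning

    -+-interchangeℤ : ∀ (a b c d : ℤ) → (a ℤ.+ b) ℤ.- (c ℤ.+ d) ≡ (a ℤ.- c) ℤ.+ (b ℤ.- d)
    -+-interchangeℤ = solve-∀

    -+-interchange : ∀ a b c d → + (a + b) ℤ.- + (c + d) ≡ (+ a ℤ.- + c) ℤ.+ (+ b ℤ.- + d)
    -+-interchange a b c d = trans (cong₂ ℤ._-_ (ℤ.pos-+ a b) (ℤ.pos-+ c d))
      (-+-interchangeℤ (+ a) (+ b) (+ c) (+ d))

  vℚ-* : ∀ {x y} → x ≢ 0ℚ → y ≢ 0ℚ → x ℚ.* y ≢ 0ℚ × vℚ (x ℚ.* y) ≡ vℚ x ℤ.+ vℚ y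
  vℚ-* {x@(ℚ.mkℚ a b _)} {y@(ℚ.mkℚ c d _)} x≢0 y≢0 =
    ≃⇒≢0 (x ℚ.* y) _ homo ↥≢0 , (begin
      vℚ (x ℚ.* y)                                               ≡⟨ vℚ-≃ (x ℚ.* y) _ homo ↥≢0 ⟩
      + νℤ (a ℤ.* c) ℤ.- + ν (suc b * suc d)
        ≡⟨ cong₂ (λ m n → + m ℤ.- + n) (νℤ-* (≢0⇒↥≢0 x≢0) (≢0⇒↥≢0 y≢0))
                                        (ν-* (s≤s z≤n) (s≤s z≤n)) ⟩
      + (νℤ a + νℤ c) ℤ.- + (ν (suc b) + ν (suc d))
        ≡⟨ -+-interchange (νℤ a) (νℤ c) (ν (suc b)) (ν (suc d)) ⟩
      vℚ x ℤ.+ vℚ y                                               ∎)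
    where
    open ≡-Reasoning
    homo = ℚ.toℚᵘ-homo-* x y
    ↥≢0 = *≢0 (≢0⇒↥≢0 x≢0) (≢0⇒↥≢0 y≢0)

  private
    -- x + y for x = a / (1 + b) and y = c / (1 + d) is (A + B) / ((1 + b)(1 + d)) before reduction.
    module CommonDenominator (a : ℤ) (b : ℕ) (c : ℤ) (d : ℕ) (a≢0 : a ≢ 0ℤ) (c≢0 : c ≢ 0ℤ) where
      A B : ℤ
      A = a ℤ.* + suc d
      B = c ℤ.* + suc b
      D : ℕ
      D = ν (suc b * suc d)

      A≢0 : A ≢ 0ℤ
      A≢0 = *≢0 a≢0 (λ ())
      B≢0 : B ≢ 0ℤ
      B≢0 = *≢0 c≢0 (λ ())

      vx≡ : + νℤ a ℤ.- + ν (suc b) ≡ + νℤ A ℤ.- + D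
      vx≡ = diff-≡ (νℤ a) (ν (suc b)) (νℤ A) D (begin
        νℤ a + D                        ≡⟨ cong (νℤ a ℕ.+_) (ν-* (s≤s z≤n) (s≤s z≤n)) ⟩
        νℤ a + (ν (suc b) + ν (suc d))  ≡⟨ cong (νℤ a ℕ.+_) (+-comm (ν (suc b)) _) ⟩
        νℤ a + (ν (suc d) + ν (suc b))  ≡⟨ +-assoc (νℤ a) _ _ ⟨
        νℤ a + ν (suc d) + ν (suc b)    ≡⟨ cong (_+ ν (suc b)) (νℤ-* a≢0 (λ ())) ⟨
        νℤ A + ν (suc b)                ∎)
        where open ≡-Reasoning

      vy≡ : + νℤ c ℤ.- + ν (suc d) ≡ + νℤ B ℤ.- + D
      vy≡ = diff-≡ (νℤ c) (ν (suc d)) (νℤ B) D (begin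
        νℤ c + D                        ≡⟨ cong (νℤ c ℕ.+_) (ν-* (s≤s z≤n) (s≤s z≤n)) ⟩
        νℤ c + (ν (suc b) + ν (suc d))  ≡⟨ +-assoc (νℤ c) _ _ ⟨
        νℤ c + ν (suc b) + ν (suc d)    ≡⟨ cong (_+ ν (suc d)) (νℤ-* c≢0 (λ ())) ⟨
        νℤ B + ν (suc d)                ∎)
        where open ≡-Reasoning

  vℚ-ultrametric : ∀ {x y} → x ≢ 0ℚ → y ≢ 0ℚ → x ℚ.+ y ≢ 0ℚ →
                   vℚ x ℤ.≤ vℚ (x ℚ.+ y) ⊎ vℚ y ℤ.≤ vℚ (x ℚ.+ y)
  vℚ-ultrametric {x@(ℚ.mkℚ a b _)} {y@(ℚ.mkℚ c d _)} x≢0 y≢0 x+y≢0 =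
    Sum.map (transfer vx≡) (transfer vy≡) (νℤ-ultrametric A≢0 B≢0 A+B≢0)
    where
    open CommonDenominator a b c d (≢0⇒↥≢0 x≢0) (≢0⇒↥≢0 y≢0)
    homo = ℚ.toℚᵘ-homo-+ x y
    A+B≢0 : A ℤ.+ B ≢ 0ℤ
    A+B≢0 = ≃∧≢0⇒↥ᵘ≢0 (x ℚ.+ y) _ homo x+y≢0
    transfer : ∀ {m v} → v ≡ + m ℤ.- + D → m ≤ νℤ (A ℤ.+ B) → v ℤ.≤ vℚ (x ℚ.+ y)
    transfer v≡ m≤ = subst₂ ℤ._≤_ (sym v≡) (sym (vℚ-≃ (x ℚ.+ y) _ homo A+B≢0))
                                  (diff-≤ _ D _ D (+-monoˡ-≤ D m≤))

  vℚ-+-dominant : ∀ {x y} → x ≢ 0ℚ → y ≢ 0ℚ → vℚ x ℤ.< vℚ y →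
                  x ℚ.+ y ≢ 0ℚ × vℚ (x ℚ.+ y) ≡ vℚ x
  vℚ-+-dominant {x@(ℚ.mkℚ a b _)} {y@(ℚ.mkℚ c d _)} x≢0 y≢0 vx<vy =
    ≃⇒≢0 (x ℚ.+ y) _ homo A+B≢0 ,
    trans (vℚ-≃ (x ℚ.+ y) _ homo A+B≢0) (trans (cong (λ m → + m ℤ.- + D) νA+B≡) (sym vx≡))
    where
    open CommonDenominator a b c d (≢0⇒↥≢0 x≢0) (≢0⇒↥≢0 y≢0)
    homo = ℚ.toℚᵘ-homo-+ x y
    dominant = νℤ-+-dominant A≢0 B≢0 (diff-cancel-< D (subst₂ ℤ._<_ vx≡ vy≡ vx<vy))
    A+B≢0 = proj₁ dominant
    νA+B≡ = proj₂ dominant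

  vℚ-/1 : ∀ {z} → z ≢ 0ℤ → vℚ (z ℚ./ 1) ≡ + νℤ z
  vℚ-/1 {z} z≢0 = trans (vℚ-≃ (z ℚ./ 1) (ℚᵘ.mkℚᵘ z 0) (ℚ.toℚᵘ-fromℚᵘ (ℚᵘ.mkℚᵘ z 0)) z≢0)
                        (trans (cong (λ m → + νℤ z ℤ.- + m) (ν-p∤ p∤1)) (ℤ.+-identityʳ _))

module NewtonPolygon {p : ℕ} (p-prime : Prime p) (β : ℕ) (α : ℤ) where

  open Valuation p-prime

  -- The point (m, vℚ x) of the Newton diagram, measured against lines of slope α / β.
  weight : ℚ → ℕ → ℤ
  weight x m = + β ℤ.* vℚ x ℤ.- α ℤ.* + m

  -- Zero coefficients have no point in the diagram and count as lying above every line.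
  Above : ℤ → ℕ → ℚ → Set
  Above M m x = x ≡ 0ℚ ⊎ (x ≢ 0ℚ × M ℤ.≤ weight x m)

  On : ℤ → ℕ → ℚ → Set
  On M m x = x ≢ 0ℚ × weight x m ≡ M

  weight-mono : ∀ x y m → vℚ x ℤ.≤ vℚ y → weight x m ℤ.≤ weight y m
  weight-mono _ _ m vx≤vy = ℤ.+-monoˡ-≤ _ (ℤ.*-monoˡ-≤-nonNeg (+ β) vx≤vy)

  weight-* : ∀ {x y} i j → x ≢ 0ℚ → y ≢ 0ℚ →
             x ℚ.* y ≢ 0ℚ × weight (x ℚ.* y) (i + j) ≡ weight x i ℤ.+ weight y j
  weight-* {x} {y} i j x≢0 y≢0 =
    let xy≢0 , vxy≡ = vℚ-* x≢0 y≢0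
    in xy≢0 , trans (cong₂ (λ v m → + β ℤ.* v ℤ.- α ℤ.* m) vxy≡ (ℤ.pos-+ i j))
                    (distrib (+ β) α (vℚ x) (vℚ y) (+ i) (+ j))
    where
    distrib : ∀ (b a u v i j : ℤ) →
              b ℤ.* (u ℤ.+ v) ℤ.- a ℤ.* (i ℤ.+ j) ≡ (b ℤ.* u ℤ.- a ℤ.* i) ℤ.+ (b ℤ.* v ℤ.- a ℤ.* j)
    distrib = solve-∀

  On⇒Above : ∀ {M m x} → On M m x → Above M m x
  On⇒Above (x≢0 , w≡M) = inj₂ (x≢0 , ℤ.≤-reflexive (sym w≡M))

  Above-weaken : ∀ {M N m x} → M ℤ.≤ N → Above N m x → Above M m x
  Above-weaken M≤N (inj₁ x≡0)        = inj₁ x≡0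
  Above-weaken M≤N (inj₂ (x≢0 , N≤)) = inj₂ (x≢0 , ℤ.≤-trans M≤N N≤)

  On∧Above⇒≤ : ∀ {M N m x} → On M m x → Above N m x → N ℤ.≤ M
  On∧Above⇒≤ (x≢0 , _)   (inj₁ x≡0)      = ⊥-elim (x≢0 x≡0)
  On∧Above⇒≤ (_ , w≡M)   (inj₂ (_ , N≤)) = subst (_ ℤ.≤_) w≡M N≤

  On∧On⇒≡ : ∀ {M N m x} → On M m x → On N m x → M ≡ N
  On∧On⇒≡ (_ , w≡M) (_ , w≡N) = trans (sym w≡M) w≡N

  On∧Above-suc⇒⊥ : ∀ {M m x} → On M m x → ¬ Above (ℤ.suc M) m x
  On∧Above-suc⇒⊥ on above = ℤ.<-irrefl refl (ℤ.suc[i]≤j⇒i<j (On∧Above⇒≤ on above))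

  Above-+ : ∀ {M m x y} → Above M m x → Above M m y → Above M m (x ℚ.+ y)
  Above-+ {y = y} (inj₁ refl) above-y = subst (Above _ _) (sym (ℚ.+-identityˡ y)) above-y
  Above-+ {x = x} above-x@(inj₂ _) (inj₁ refl) = subst (Above _ _) (sym (ℚ.+-identityʳ x)) above-x
  Above-+ {M} {m} {x} {y} (inj₂ (x≢0 , M≤x)) (inj₂ (y≢0 , M≤y)) with x ℚ.+ y ℚ.≟ 0ℚ
  ... | yes x+y≡0 = inj₁ x+y≡0
  ... | no  x+y≢0 = inj₂ (x+y≢0 , Sum.[ (λ vx≤ → ℤ.≤-trans M≤x (weight-mono x (x ℚ.+ y) m vx≤))
                                     , (λ vy≤ → ℤ.≤-trans M≤y (weight-mono y (x ℚ.+ y) m vy≤)) ]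
                                     (vℚ-ultrametric x≢0 y≢0 x+y≢0))

  On-+ : ∀ {M m x y} → On M m x → Above (ℤ.suc M) m y → On M m (x ℚ.+ y)
  On-+ {x = x} on-x (inj₁ refl) = subst (On _ _) (sym (ℚ.+-identityʳ x)) on-x
  On-+ {M} {m} {x} {y} (x≢0 , wx≡M) (inj₂ (y≢0 , M<y)) =
    let x+y≢0 , vx+y≡vx = vℚ-+-dominant x≢0 y≢0 vx<vy
    in x+y≢0 , trans (cong (λ v → + β ℤ.* v ℤ.- α ℤ.* + m) vx+y≡vx) wx≡M
    where
    wx<wy : weight x m ℤ.< weight y m
    wx<wy = ℤ.suc[i]≤j⇒i<j (subst (λ w → ℤ.suc w ℤ.≤ weight y m) (sym wx≡M) M<y)
    vx<vy : vℚ x ℤ.< vℚ y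
    vx<vy = ℤ.≰⇒> (λ vy≤vx → ℤ.<⇒≱ wx<wy (weight-mono y x m vy≤vx))

  Above-* : ∀ {M N i j x y} → Above M i x → Above N j y → Above (M ℤ.+ N) (i + j) (x ℚ.* y)
  Above-* {y = y} (inj₁ refl) _ = inj₁ (ℚ.*-zeroˡ y)
  Above-* {x = x} (inj₂ _) (inj₁ refl) = inj₁ (ℚ.*-zeroʳ x)
  Above-* {i = i} {j} (inj₂ (x≢0 , M≤)) (inj₂ (y≢0 , N≤)) =
    let xy≢0 , w≡ = weight-* i j x≢0 y≢0
    in inj₂ (xy≢0 , subst (_ ℤ.≤_) (sym w≡) (ℤ.+-mono-≤ M≤ N≤))

  On-* : ∀ {M N i j x y} → On M i x → On N j y → On (M ℤ.+ N) (i + j) (x ℚ.* y)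
  On-* {i = i} {j} (x≢0 , wx≡) (y≢0 , wy≡) =
    let xy≢0 , w≡ = weight-* i j x≢0 y≢0 in xy≢0 , trans w≡ (cong₂ ℤ._+_ wx≡ wy≡)

  -- The lowest line of slope α / β meeting the Newton diagram of g, touching it from index first to last.
  record Support (g : ℕ → ℚ) : Set where
    field
      height       : ℤ
      first last   : ℕ
      on-first     : On height first (g first)
      on-last      : On height last (g last)
      above        : ∀ i → Above height i (g i)
      above-before : ∀ i → i < first → Above (ℤ.suc height) i (g i)
      above-after  : ∀ i → last < i → Above (ℤ.suc height) i (g i)

    first≤ : ∀ {i} → On height i (g i) → first ≤ i
    first≤ {i} on = ≮⇒≥ (λ i<first → On∧Above-suc⇒⊥ on (above-before i i<first))

    ≤last : ∀ {i} → On height i (g i) → i ≤ last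
    ≤last {i} on = ≮⇒≥ (λ last<i → On∧Above-suc⇒⊥ on (above-after i last<i))

    first≤last : first ≤ last
    first≤last = ≤last on-first

  private
    record PartialSupport (g : ℕ → ℚ) (t : ℕ) : Set where
      field
        height       : ℤ
        first last   : ℕ
        last<t       : last < t
        on-first     : On height first (g first)
        on-last      : On height last (g last)
        above        : ∀ i → i < t → Above height i (g i)
        above-before : ∀ i → i < first → Above (ℤ.suc height) i (g i)
        above-after  : ∀ i → last < i → i < t → Above (ℤ.suc height) i (g i)

    <-suc-elim : ∀ {t i} {P : ℕ → Set} → (i < t → P i) → P t → i < suc t → P i
    <-suc-elim {P = P} below at i<1+t =
      Sum.[ below , (λ { refl → at }) ] (m<1+n⇒m<n∨m≡n i<1+t)

    start : ∀ {g t M} → On M t (g t) → (∀ i → i < t → Above (ℤ.suc M) i (g i)) →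
            PartialSupport g (suc t)
    start {g} {t} {M} on strictly-above = record
      { height = M ; first = t ; last = t ; last<t = ≤-refl
      ; on-first = on ; on-last = on
      ; above = λ i → <-suc-elim (λ i<t → Above-weaken (ℤ.i≤suc[i] M) (strictly-above i i<t)) (On⇒Above on)
      ; above-before = strictly-above
      ; above-after = λ i t<i i<1+t → ⊥-elim (<⇒≱ t<i (m<1+n⇒m≤n i<1+t)) }

    extend-last : ∀ {g t} (S : PartialSupport g t) → On (PartialSupport.height S) t (g t) →
                  PartialSupport g (suc t)
    extend-last {g} {t} S on = record
      { height = height ; first = first ; last = t ; last<t = ≤-refl
      ; on-first = on-first ; on-last = on
      ; above = λ i → <-suc-elim (above i) (On⇒Above on)
      ; above-before = above-before
      ; above-after = λ i t<i i<1+t → ⊥-elim (<⇒≱ t<i (m<1+n⇒m≤n i<1+t)) }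
      where open PartialSupport S

    extend-above : ∀ {g t} (S : PartialSupport g t) → Above (ℤ.suc (PartialSupport.height S)) t (g t) →
                   PartialSupport g (suc t)
    extend-above {g} {t} S above-t = record
      { height = height ; first = first ; last = last ; last<t = m≤n⇒m≤1+n last<t
      ; on-first = on-first ; on-last = on-last
      ; above = λ i → <-suc-elim (above i) (Above-weaken (ℤ.i≤suc[i] height) above-t)
      ; above-before = above-before
      ; above-after = λ i last<i → <-suc-elim (above-after i last<i) above-t }
      where open PartialSupport S

    partialSupport : ∀ g t → (∀ i → i < t → g i ≡ 0ℚ) ⊎ PartialSupport g t
    partialSupport g zero = inj₁ (λ i ())
    partialSupport g (suc t) with g t ℚ.≟ 0ℚ | partialSupport g t
    ... | yes gt≡0 | inj₁ zeros = inj₁ (λ i → <-suc-elim (zeros i) gt≡0)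
    ... | yes gt≡0 | inj₂ S     = inj₂ (extend-above S (inj₁ gt≡0))
    ... | no  gt≢0 | inj₁ zeros = inj₂ (start (gt≢0 , refl) (λ i i<t → inj₁ (zeros i i<t)))
    ... | no  gt≢0 | inj₂ S     with ℤ.<-cmp (weight (g t) t) (PartialSupport.height S)
    ...   | tri< w<M _ _ = inj₂ (start (gt≢0 , refl)
                             (λ i i<t → Above-weaken (ℤ.i<j⇒suc[i]≤j w<M) (PartialSupport.above S i i<t)))
    ...   | tri≈ _ w≡M _ = inj₂ (extend-last S (gt≢0 , w≡M))
    ...   | tri> _ _ M<w = inj₂ (extend-above S (inj₂ (gt≢0 , ℤ.i<j⇒suc[i]≤j M<w)))

  support : ∀ {g d} → HasDegree g d → Support g
  support {g} {d} (gd≢0 , beyond) with partialSupport g (suc d)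
  ... | inj₁ zeros = ⊥-elim (gd≢0 (zeros d ≤-refl))
  ... | inj₂ S = record
    { height = height ; first = first ; last = last
    ; on-first = on-first ; on-last = on-last
    ; above = λ i → up-to-degree i (above i) (λ d<i → inj₁ (beyond i d<i))
    ; above-before = above-before
    ; above-after = λ i last<i → up-to-degree i (above-after i last<i) (λ d<i → inj₁ (beyond i d<i)) }
    where
    open PartialSupport S
    up-to-degree : ∀ {A : Set} i → (i < suc d → A) → (d < i → A) → A
    up-to-degree i low high with i ≤? d
    ... | yes i≤d = low (s≤s i≤d)
    ... | no  i≰d = high (≰⇒> i≰d)

  module _ {g h : ℕ → ℚ} where

    private
      term : ℕ → ℕ → ℚ
      term m i = g i ℚ.* h (m ∸ i)

    convAux-Above : ∀ {M m} t → (∀ i → i < t → Above M m (term m i)) → Above M m (convAux g h m t)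
    convAux-Above zero    _     = inj₁ refl
    convAux-Above (suc t) above =
      Above-+ (convAux-Above t (λ i i<t → above i (m≤n⇒m≤1+n i<t))) (above t ≤-refl)

    convAux-On : ∀ {M m} t i₀ → i₀ < t → On M m (term m i₀) →
                 (∀ i → i < t → i ≢ i₀ → Above (ℤ.suc M) m (term m i)) → On M m (convAux g h m t)
    convAux-On {M} {m} (suc t) i₀ i₀<1+t on others with t ≟ i₀
    ... | yes refl = subst (On M m) (ℚ.+-comm (term m t) _)
                       (On-+ on (convAux-Above t (λ i i<t → others i (m≤n⇒m≤1+n i<t) (<⇒≢ i<t))))
    ... | no  t≢i₀ = On-+ (convAux-On t i₀ (≤∧≢⇒< (m<1+n⇒m≤n i₀<1+t) (≢-sym t≢i₀)) on
                            (λ i i<t → others i (m≤n⇒m≤1+n i<t)))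
                          (others t ≤-refl t≢i₀)

    term-Above : ∀ {M N m i} → i ≤ m → Above M i (g i) → Above N (m ∸ i) (h (m ∸ i)) →
                 Above (M ℤ.+ N) m (term m i)
    term-Above {M} {N} {m} {i} i≤m above-g above-h =
      subst (λ k → Above (M ℤ.+ N) k (term m i)) (m+[n∸m]≡n i≤m) (Above-* above-g above-h)

    term-On : ∀ {M N i j} → On M i (g i) → On N j (h j) → On (M ℤ.+ N) (i + j) (term (i + j) i)
    term-On {M} {N} {i} {j} on-g on-h =
      subst (λ k → On (M ℤ.+ N) (i + j) (g i ℚ.* h k)) (sym (m+n∸m≡n i j)) (On-* on-g on-h)

    support-* : Support g → Support h → Support (polyMulCoeff g h)
    support-* G H = record
      { height = G.height ℤ.+ H.height
      ; first = G.first + H.first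
      ; last = G.last + H.last
      ; on-first = convAux-On _ G.first (s≤s (m≤m+n _ _)) (term-On G.on-first H.on-first)
          (λ i i<1+m i≢first → below-firsts (i≤ i<1+m) (+≡+⇒<⊎< (i+[m∸i] i<1+m) i≢first))
      ; on-last = convAux-On _ G.last (s≤s (m≤m+n _ _)) (term-On G.on-last H.on-last)
          (λ i i<1+m i≢last → beyond-lasts (i≤ i<1+m) (+≡+⇒<⊎< (sym (i+[m∸i] i<1+m)) (≢-sym i≢last)))
      ; above = λ m → convAux-Above (suc m) (λ i i<1+m → term-Above (i≤ i<1+m) (G.above i) (H.above (m ∸ i)))
      ; above-before = λ m m<first → convAux-Above (suc m) (λ i i<1+m →
          below-firsts (i≤ i<1+m) (+<+⇒<⊎< (subst (_< _) (sym (i+[m∸i] i<1+m)) m<first)))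
      ; above-after = λ m last<m → convAux-Above (suc m) (λ i i<1+m →
          beyond-lasts (i≤ i<1+m) (+<+⇒<⊎< (subst (_ <_) (sym (i+[m∸i] i<1+m)) last<m))) }
      where
      module G = Support G
      module H = Support H

      i≤ : ∀ {m i} → i < suc m → i ≤ m
      i≤ = m<1+n⇒m≤n

      i+[m∸i] : ∀ {m i} → i < suc m → i + (m ∸ i) ≡ m
      i+[m∸i] i<1+m = m+[n∸m]≡n (i≤ i<1+m)

      raise-g : ∀ {m i} → i ≤ m → Above (ℤ.suc G.height) i (g i) →
                Above (ℤ.suc (G.height ℤ.+ H.height)) m (term m i)
      raise-g i≤m above = subst (λ M → Above M _ _) (ℤ.+-assoc ℤ.1ℤ G.height H.height)
                            (term-Above i≤m above (H.above _))

      raise-h : ∀ {m i} → i ≤ m → Above (ℤ.suc H.height) (m ∸ i) (h (m ∸ i)) →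
                Above (ℤ.suc (G.height ℤ.+ H.height)) m (term m i)
      raise-h i≤m above = subst (λ M → Above M _ _) suc-inside (term-Above i≤m (G.above _) above)
        where
        suc-inside : G.height ℤ.+ ℤ.suc H.height ≡ ℤ.suc (G.height ℤ.+ H.height)
        suc-inside = trans (sym (ℤ.+-assoc G.height ℤ.1ℤ H.height))
          (trans (cong (ℤ._+ H.height) (ℤ.+-comm G.height ℤ.1ℤ)) (ℤ.+-assoc ℤ.1ℤ G.height H.height))

      below-firsts : ∀ {m i} → i ≤ m → i < G.first ⊎ m ∸ i < H.first →
                     Above (ℤ.suc (G.height ℤ.+ H.height)) m (term m i)
      below-firsts i≤m = Sum.[ raise-g i≤m ∘ G.above-before _ , raise-h i≤m ∘ H.above-before _ ]

      beyond-lasts : ∀ {m i} → i ≤ m → G.last < i ⊎ H.last < m ∸ i →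
                     Above (ℤ.suc (G.height ℤ.+ H.height)) m (term m i)
      beyond-lasts i≤m = Sum.[ raise-g i≤m ∘ G.above-after _ , raise-h i≤m ∘ H.above-after _ ]

  -- [L, H] is an edge of slope α / β of the Newton polygon of f, with no other point of the diagram on it.
  record ExactSupport (f : ℕ → ℚ) (L H : ℕ) : Set where
    field
      height       : ℤ
      L≤H          : L ≤ H
      on-L         : On height L (f L)
      on-H         : On height H (f H)
      above-others : ∀ j → j ≢ L → j ≢ H → Above (ℤ.suc height) j (f j)

  exactSupport-cong : ∀ {f f′ L H} → (∀ m → f m ≡ f′ m) → ExactSupport f L H → ExactSupport f′ L H
  exactSupport-cong {L = L} {H} f≡f′ E = record
    { height = height ; L≤H = L≤H
    ; on-L = subst (On height L) (f≡f′ L) on-L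
    ; on-H = subst (On height H) (f≡f′ H) on-H
    ; above-others = λ j j≢L j≢H → subst (Above _ j) (f≡f′ j) (above-others j j≢L j≢H) }
    where open ExactSupport E

  support-exact : ∀ {f L H} (S : Support f) → ExactSupport f L H →
                  Support.first S ≡ L × Support.last S ≡ H
  support-exact {f} {L} {H} S E =
    ≤-antisym (S.first≤ (subst (λ M → On M L (f L)) (sym heights) E.on-L)) (L≤ S.first S.on-first) ,
    ≤-antisym (≤H S.last S.on-last) (S.≤last (subst (λ M → On M H (f H)) (sym heights) E.on-H))
    where
    module S = Support S
    module E = ExactSupport E

    S≤E : S.height ℤ.≤ E.height
    S≤E = On∧Above⇒≤ E.on-L (S.above L)

    on⇒L∨H : ∀ {i} → On S.height i (f i) → i ≡ L ⊎ i ≡ H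
    on⇒L∨H {i} on with i ≟ L | i ≟ H
    ... | yes i≡L | _       = inj₁ i≡L
    ... | no  _   | yes i≡H = inj₂ i≡H
    ... | no i≢L  | no i≢H  = ⊥-elim (ℤ.<-irrefl refl (ℤ.suc[i]≤j⇒i<j
                                (ℤ.≤-trans (On∧Above⇒≤ on (E.above-others i i≢L i≢H)) S≤E)))

    heights : S.height ≡ E.height
    heights with on⇒L∨H S.on-first
    ... | inj₁ refl = On∧On⇒≡ S.on-first E.on-L
    ... | inj₂ refl = On∧On⇒≡ S.on-first E.on-H

    L≤ : ∀ i → On S.height i (f i) → L ≤ i
    L≤ i on = Sum.[ (λ { refl → ≤-refl }) , (λ { refl → E.L≤H }) ] (on⇒L∨H on)

    ≤H : ∀ i → On S.height i (f i) → i ≤ H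
    ≤H i on = Sum.[ (λ { refl → E.L≤H }) , (λ { refl → ≤-refl }) ] (on⇒L∨H on)

  support-slope : ∀ {g} (S : Support g) → β ∣ ∣ α ∣ * (Support.last S ∸ Support.first S)
  support-slope {g} S = divides ∣ vH ℤ.- vL ∣ (begin
    ∣ α ∣ * (last ∸ first)                 ≡⟨ ℤ.abs-* α (+ (last ∸ first)) ⟨
    ∣ α ℤ.* + (last ∸ first) ∣             ≡⟨ cong ∣_∣ α*Δ≡β*Δv ⟩
    ∣ + β ℤ.* (vH ℤ.- vL) ∣                ≡⟨ ℤ.abs-* (+ β) (vH ℤ.- vL) ⟩
    β * ∣ vH ℤ.- vL ∣                      ≡⟨ *-comm β _ ⟩
    ∣ vH ℤ.- vL ∣ * β                      ∎)
    where
    open Support S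
    open ≡-Reasoning
    vL = vℚ (g first)
    vH = vℚ (g last)
    Δ≡ : + (last ∸ first) ≡ + last ℤ.- + first
    Δ≡ = trans (sym (ℤ.≤-⊖ first≤last)) (sym (ℤ.[+m]-[+n]≡m⊖n last first))
    rearrange : ∀ (a b vh vl l f : ℤ) →
                a ℤ.* (l ℤ.- f) ≡
                ((b ℤ.* vl ℤ.- a ℤ.* f) ℤ.- (b ℤ.* vh ℤ.- a ℤ.* l)) ℤ.+ b ℤ.* (vh ℤ.- vl)
    rearrange = solve-∀
    α*Δ≡β*Δv : α ℤ.* + (last ∸ first) ≡ + β ℤ.* (vH ℤ.- vL)
    α*Δ≡β*Δv = begin
      α ℤ.* + (last ∸ first)                                         ≡⟨ cong (α ℤ.*_) Δ≡ ⟩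
      α ℤ.* (+ last ℤ.- + first)                                     ≡⟨ rearrange α (+ β) vH vL (+ last) (+ first) ⟩
      (weight (g first) first ℤ.- weight (g last) last) ℤ.+ + β ℤ.* (vH ℤ.- vL)
        ≡⟨ cong (λ w → (w ℤ.- weight (g last) last) ℤ.+ + β ℤ.* (vH ℤ.- vL))
                (trans (proj₂ on-first) (sym (proj₂ on-last))) ⟩
      (weight (g last) last ℤ.- weight (g last) last) ℤ.+ + β ℤ.* (vH ℤ.- vL)
        ≡⟨ cong (ℤ._+ + β ℤ.* (vH ℤ.- vL)) (ℤ.+-inverseʳ (weight (g last) last)) ⟩
      0ℤ ℤ.+ + β ℤ.* (vH ℤ.- vL)                                     ≡⟨ ℤ.+-identityˡ _ ⟩
      + β ℤ.* (vH ℤ.- vL)                                             ∎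

  last≤degree : ∀ {g d} (S : Support g) → HasDegree g d → Support.last S ≤ d
  last≤degree S (_ , beyond) = ≮⇒≥ (λ d<last → proj₁ (Support.on-last S) (beyond _ d<last))

  -- How an edge [L, H] of the Newton polygon of g·h is made up of edges of g and h (Dumas).
  record EdgeSplit (d e L H : ℕ) : Set where
    field
      Lg Lh Hg Hh : ℕ
      Lg+Lh≡L     : Lg + Lh ≡ L
      Hg+Hh≡H     : Hg + Hh ≡ H
      β∣g         : β ∣ ∣ α ∣ * (Hg ∸ Lg)
      β∣h         : β ∣ ∣ α ∣ * (Hh ∸ Lh)
      Hg≤d        : Hg ≤ d
      Hh≤e        : Hh ≤ e

  edgeSplit : ∀ {f g h d e L H} → HasDegree g d → HasDegree h e → (∀ m → f m ≡ polyMulCoeff g h m) →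
              ExactSupport f L H → EdgeSplit d e L H
  edgeSplit deg-g deg-h f≡gh E = record
    { Lg = Support.first G ; Lh = Support.first H ; Hg = Support.last G ; Hh = Support.last H
    ; Lg+Lh≡L = proj₁ ends ; Hg+Hh≡H = proj₂ ends
    ; β∣g = support-slope G ; β∣h = support-slope H
    ; Hg≤d = last≤degree G deg-g ; Hh≤e = last≤degree H deg-h }
    where
    G = support deg-g
    H = support deg-h
    ends = support-exact (support-* G H) (exactSupport-cong f≡gh E)

-- With slope 1 / 0 the weight of a nonzero coefficient is minus its index, so supports are degrees.
module Degree where

  open Valuation prime[2]
  open NewtonPolygon prime[2] 0 ℤ.1ℤ

  weight≡-index : ∀ x m → weight x m ≡ ℤ.- + m
  weight≡-index x m = trans (cong₂ ℤ._-_ (ℤ.*-zeroˡ (vℚ x)) (ℤ.*-identityˡ (+ m))) (ℤ.+-identityˡ _)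

  hasDegree⇒exactSupport : ∀ {g d} → HasDegree g d → ExactSupport g d d
  hasDegree⇒exactSupport {g} {d} (gd≢0 , beyond) = record
    { height = ℤ.- + d ; L≤H = ≤-refl
    ; on-L = gd≢0 , weight≡-index (g d) d ; on-H = gd≢0 , weight≡-index (g d) d
    ; above-others = others }
    where
    others : ∀ j → j ≢ d → j ≢ d → Above (ℤ.suc (ℤ.- + d)) j (g j)
    others j j≢d _ with g j ℚ.≟ 0ℚ | <-cmp j d
    ... | yes gj≡0 | _ = inj₁ gj≡0
    ... | no  gj≢0 | tri< j<d _ _ = inj₂ (gj≢0 , subst (ℤ.suc (ℤ.- + d) ℤ.≤_) (sym (weight≡-index (g j) j))
                                      (ℤ.i<j⇒suc[i]≤j (ℤ.neg-mono-< (ℤ.+<+ j<d))))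
    ... | no  gj≢0 | tri≈ _ j≡d _ = ⊥-elim (j≢d j≡d)
    ... | no  gj≢0 | tri> _ _ d<j = ⊥-elim (gj≢0 (beyond j d<j))

  degree-* : ∀ {f g h d e k} → HasDegree g d → HasDegree h e → HasDegree f k →
             (∀ m → f m ≡ polyMulCoeff g h m) → d + e ≡ k
  degree-* {d = d} {e} {k} deg-g deg-h deg-f f≡gh = begin
    d + e                   ≡⟨ cong₂ _+_ (proj₁ (support-exact G (hasDegree⇒exactSupport deg-g)))
                                         (proj₁ (support-exact H (hasDegree⇒exactSupport deg-h))) ⟨
    Support.first G + Support.first H
      ≡⟨ proj₁ (support-exact (support-* G H) (exactSupport-cong f≡gh (hasDegree⇒exactSupport deg-f))) ⟩
    k                       ∎
    where
    open ≡-Reasoning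
    G = support deg-g
    H = support deg-h

-- Binomial coefficients

rising : ℕ → ℕ → ℕ
rising b zero    = 1
rising b (suc j) = suc b * rising (suc b) j

rising>0 : ∀ b j → 0 < rising b j
rising>0 b zero    = s≤s z≤n
rising>0 b (suc j) = *-mono-≤ {1} {suc b} (s≤s z≤n) (rising>0 (suc b) j)

rising-+ : ∀ b i j → rising b (i + j) ≡ rising b i * rising (b + i) j
rising-+ b zero    j = sym (trans (+-identityʳ (rising (b + 0) j)) (cong (λ c → rising c j) (+-identityʳ b)))
rising-+ b (suc i) j = begin
  suc b * rising (suc b) (i + j)                        ≡⟨ cong (suc b *_) (rising-+ (suc b) i j) ⟩
  suc b * (rising (suc b) i * rising (suc b + i) j)     ≡⟨ *-assoc (suc b) (rising (suc b) i) _ ⟨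
  suc b * rising (suc b) i * rising (suc b + i) j
    ≡⟨ cong (λ c → suc b * rising (suc b) i * rising c j) (+-suc b i) ⟨
  suc b * rising (suc b) i * rising (b + suc i) j       ∎
  where open ≡-Reasoning

P′≡rising : ∀ b j → (b + j) P′ j ≡ rising b j
P′≡rising b zero    = refl
P′≡rising b (suc j) = cong₂ _*_ (trans (cong (_∸ j) (+-suc b j)) (m+n∸n≡m (suc b) j))
                                (trans (cong (_P′ j) (+-suc b j)) (P′≡rising (suc b) j))

P≡P′ : ∀ {n j} → j ≤ n → n P j ≡ n P′ j
P≡P′ {n} {j} j≤n with j ℕ.≤ᵇ n | ≤⇒≤ᵇ j≤n
... | true | _ = refl

C*!≡P′ : ∀ {n j} → j ≤ n → (n C j) * j ! ≡ n P′ j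
C*!≡P′ {n} {j} j≤n with k!∣nP′k j≤n
... | divides q P′≡q*j! = trans (cong (_* j !) C≡q) (sym P′≡q*j!)
  where
  instance _ = j !≢0
  C≡q : n C j ≡ q
  C≡q = trans (nCk≡nPk/k! j≤n) (trans (/-congˡ (trans (P≡P′ j≤n) P′≡q*j!)) (m*n/n≡m q (j !)))

C>0 : ∀ {n j} → j ≤ n → 0 < n C j
C>0 {n} {j} j≤n = n≢0⇒n>0 (λ C≡0 → <⇒≢ (rising>0 (n ∸ j) j) (sym (begin
  rising (n ∸ j) j     ≡⟨ P′≡rising (n ∸ j) j ⟨
  (n ∸ j + j) P′ j     ≡⟨ cong (_P′ j) (m∸n+n≡m j≤n) ⟩
  n P′ j               ≡⟨ C*!≡P′ j≤n ⟨
  (n C j) * j !          ≡⟨ cong (_* j !) C≡0 ⟩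
  0                    ∎)))
  where open ≡-Reasoning

module BinomialValuation {p : ℕ} (p-prime : Prime p) where

  open Valuation p-prime

  p∤! : ∀ {j} → j < p → ¬ p ∣ j !
  p∤! {zero}  _   = p∤1
  p∤! {suc j} j<p p∣j! with euclidsLemma (suc j) (j !) p-prime p∣j!
  ... | inj₁ p∣1+j = <⇒≱ j<p (∣⇒≤ p∣1+j)
  ... | inj₂ p∣j!′ = p∤! (<-trans (n<1+n j) j<p) p∣j!′

  ν-C≡ν-P′ : ∀ {n j} → j ≤ n → j < p → ν (n C j) ≡ ν (n P′ j)
  ν-C≡ν-P′ {n} {j} j≤n j<p = begin
    ν (n C j)                ≡⟨ +-identityʳ _ ⟨
    ν (n C j) + 0            ≡⟨ cong (ν (n C j) ℕ.+_) (ν-p∤ (p∤! j<p)) ⟨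
    ν (n C j) + ν (j !)      ≡⟨ ν-* (C>0 j≤n) (1≤n! j) ⟨
    ν ((n C j) * j !)        ≡⟨ cong ν (C*!≡P′ j≤n) ⟩
    ν (n P′ j)               ∎
    where open ≡-Reasoning

  private
    window-gap : ∀ {s k x y} → s < x → y ≤ s + suc k → y ∸ x ≤ k
    window-gap {s} {k} s<x y≤ =
      ≤-trans (∸-mono y≤ s<x) (≤-reflexive (trans (cong (_∸ suc s) (+-suc s k)) (m+n∸m≡n s k)))

  p∤-window : ∀ {s k t x} → k < p → p ∣ t → s < t → t ≤ s + suc k → s < x → x ≤ s + suc k →
              x ≢ t → ¬ p ∣ x
  p∤-window {s} {k} {t} {x} k<p p∣t s<t t≤ s<x x≤ x≢t p∣x with <-cmp x t
  ... | tri< x<t _ _ = <⇒≱ (≤-<-trans (window-gap s<x t≤) k<p)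
    (∣m∣m+n⇒≤n p∣x (subst (p ∣_) (sym (m+[n∸m]≡n (<⇒≤ x<t))) p∣t) (m<n⇒0<n∸m x<t))
  ... | tri≈ _ x≡t _ = x≢t x≡t
  ... | tri> _ _ t<x = <⇒≱ (≤-<-trans (window-gap s<t x≤) k<p)
    (∣m∣m+n⇒≤n p∣t (subst (p ∣_) (sym (m+[n∸m]≡n (<⇒≤ t<x))) p∣x) (m<n⇒0<n∸m t<x))

  ν-rising≡0 : ∀ b j → (∀ x → b < x → x ≤ b + j → ¬ p ∣ x) → ν (rising b j) ≡ 0
  ν-rising≡0 b zero    _      = ν-p∤ p∤1
  ν-rising≡0 b (suc j) coprime = begin
    ν (suc b * rising (suc b) j)        ≡⟨ ν-* (s≤s z≤n) (rising>0 (suc b) j) ⟩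
    ν (suc b) + ν (rising (suc b) j)    ≡⟨ cong₂ _+_ (ν-p∤ (coprime (suc b) ≤-refl (m<m+n b (s≤s z≤n)))) IH ⟩
    0                                   ∎
    where
    open ≡-Reasoning
    IH = ν-rising≡0 (suc b) j (λ x 1+b<x x≤ →
           coprime x (<-trans (n<1+n b) 1+b<x) (≤-trans x≤ (≤-reflexive (sym (+-suc b j)))))

  ν-rising-single : ∀ b j t → b < t → t ≤ b + j → (∀ x → b < x → x ≤ b + j → x ≢ t → ¬ p ∣ x) →
                    ν (rising b j) ≡ ν t
  ν-rising-single b zero    t b<t t≤b+0 _ = ⊥-elim (<⇒≱ b<t (≤-trans t≤b+0 (≤-reflexive (+-identityʳ b))))
  ν-rising-single b (suc j) t b<t t≤ coprime = trans (ν-* (s≤s z≤n) (rising>0 (suc b) j)) (step (suc b ≟ t))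
    where
    t≤′ : t ≤ suc b + j
    t≤′ = ≤-trans t≤ (≤-reflexive (+-suc b j))
    coprime′ : ∀ x → suc b < x → x ≤ suc b + j → x ≢ t → ¬ p ∣ x
    coprime′ x 1+b<x x≤ = coprime x (<-trans (n<1+n b) 1+b<x) (≤-trans x≤ (≤-reflexive (sym (+-suc b j))))
    step : Dec (suc b ≡ t) → ν (suc b) + ν (rising (suc b) j) ≡ ν t
    step (yes refl) = trans (cong (ν t ℕ.+_) (ν-rising≡0 (suc b) j (λ x t<x x≤ →
                              coprime′ x t<x x≤ (λ x≡t → <⇒≢ t<x (sym x≡t)))))
                            (+-identityʳ (ν t))
    step (no 1+b≢t) = trans (cong₂ _+_ (ν-p∤ (coprime (suc b) ≤-refl (m<m+n b (s≤s z≤n)) 1+b≢t))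
                                       (ν-rising-single (suc b) j t (≤∧≢⇒< b<t 1+b≢t) t≤′ coprime′))
                            refl

  -- C(c + j, j) · j! · C(s + r, r) · r! · c = (s + 1)(s + 2)⋯(c + j) for c = s + r + 1, and p ∤ j! r!.
  ν-binomials : ∀ s j r → j < p → r < p →
                ν ((suc (s + r) + j) C j) + ν ((s + r) C r) + ν (suc (s + r)) ≡ ν (rising s (r + suc j))
  ν-binomials s j r j<p r<p = begin
    ν ((c + j) C j) + ν ((s + r) C r) + ν c
      ≡⟨ cong₂ (λ x y → x + y + ν c) (trans (ν-C≡ν-P′ (m≤n+m j c) j<p) (cong ν (P′≡rising c j)))
                                      (trans (ν-C≡ν-P′ (m≤n+m r s) r<p) (cong ν (P′≡rising s r))) ⟩
    ν (rising c j) + ν (rising s r) + ν c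
      ≡⟨ rearrange (ν (rising c j)) (ν (rising s r)) (ν c) ⟩
    ν (rising s r) + (ν c + ν (rising c j))
      ≡⟨ cong (ν (rising s r) ℕ.+_) (ν-* (s≤s z≤n) (rising>0 c j)) ⟨
    ν (rising s r) + ν (c * rising c j)
      ≡⟨ ν-* (rising>0 s r) (*-mono-≤ {1} {c} (s≤s z≤n) (rising>0 c j)) ⟨
    ν (rising s r * rising (s + r) (suc j))
      ≡⟨ cong ν (rising-+ s r (suc j)) ⟨
    ν (rising s (r + suc j))
      ∎
    where
    open ≡-Reasoning
    c = suc (s + r)
    rearrange : ∀ x y z → x + y + z ≡ y + (z + x)
    rearrange = ℕ-Solver.solve-∀

module SingleDrop {p : ℕ} (p-prime : Prime p) (f : ℕ → ℚ) (k i₀ E : ℕ) (1≤E : 1 ≤ E)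
                  (f≢0 : ∀ j → j ≤ k → f j ≢ 0ℚ) (f-high : ∀ j → k < j → f j ≡ 0ℚ)
                  (v-i₀ : Valuation.vℚ p-prime (f i₀) ≡ + 0)
                  (v-others : ∀ j → j ≤ k → j ≢ i₀ → Valuation.vℚ p-prime (f j) ≡ + E) where

  open Valuation p-prime

  edge-right : i₀ < k → NewtonPolygon.ExactSupport p-prime (k ∸ i₀) (+ E) f i₀ k
  edge-right i₀<k = record
    { height = + 0 ℤ.- + (E * i₀)
    ; L≤H = <⇒≤ i₀<k
    ; on-L = f≢0 i₀ (<⇒≤ i₀<k) ,
             trans (weight≡ (f i₀) i₀ v-i₀) (cong (λ x → + x ℤ.- + (E * i₀)) (*-zeroʳ w))
    ; on-H = f≢0 k ≤-refl , trans (weight≡ (f k) k (v-others k ≤-refl (≢-sym (<⇒≢ i₀<k))))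
                                  (diff-≡ (w * E) (E * k) 0 (E * i₀) w*E+E*i₀≡E*k)
    ; above-others = others }
    where
    open NewtonPolygon p-prime (k ∸ i₀) (+ E)
    w = k ∸ i₀
    weight≡ : ∀ x j {V} → vℚ x ≡ + V → weight x j ≡ + (w * V) ℤ.- + (E * j)
    weight≡ x j {V} vx≡ = cong₂ (λ a b → a ℤ.- b) (trans (cong (+ w ℤ.*_) vx≡) (sym (ℤ.pos-* w V)))
                                                     (sym (ℤ.pos-* E j))
    w*E+E*i₀≡E*k : w * E + E * i₀ ≡ 0 + E * k
    w*E+E*i₀≡E*k = trans (cong (_+ E * i₀) (*-comm w E))
                     (trans (sym (*-distribˡ-+ E w i₀)) (cong (E *_) (m∸n+n≡m (<⇒≤ i₀<k))))
    others : ∀ j → j ≢ i₀ → j ≢ k → Above (ℤ.suc (+ 0 ℤ.- + (E * i₀))) j (f j)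
    others j j≢i₀ j≢k with j ≤? k
    ... | no  j≰k = inj₁ (f-high j (≰⇒> j≰k))
    ... | yes j≤k = inj₂ (f≢0 j j≤k , subst (_ ℤ.≤_) (sym (weight≡ (f j) j (v-others j j≤k j≢i₀)))
                      (ℤ.≤-trans (ℤ.≤-reflexive (sym (ℤ.+-assoc ℤ.1ℤ (+ 0) (ℤ.- + (E * i₀)))))
                                 (diff-≤ 1 (E * i₀) (w * E) (E * j) (begin
        1 + E * j       ≤⟨ +-monoˡ-≤ (E * j) 1≤E ⟩
        E + E * j       ≡⟨ *-suc E j ⟨
        E * suc j       ≤⟨ *-monoʳ-≤ E (≤∧≢⇒< j≤k j≢k) ⟩
        E * k           ≡⟨ w*E+E*i₀≡E*k ⟨
        w * E + E * i₀  ∎))))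
      where open ≤-Reasoning

  edge-left : 0 < i₀ → i₀ ≤ k → NewtonPolygon.ExactSupport p-prime i₀ (ℤ.- + E) f 0 i₀
  edge-left 0<i₀ i₀≤k = record
    { height = + (i₀ * E) ℤ.- + 0
    ; L≤H = z≤n
    ; on-L = f≢0 0 z≤n , trans (weight≡ (f 0) 0 (v-others 0 z≤n (≢-sym (>⇒≢ 0<i₀))))
                               (cong (λ x → + x ℤ.- + 0) (trans (cong (i₀ * E ℕ.+_) (*-zeroʳ E)) (+-identityʳ _)))
    ; on-H = f≢0 i₀ i₀≤k , trans (weight≡ (f i₀) i₀ v-i₀)
                                 (cong (λ x → + x ℤ.- + 0) (trans (cong (_+ E * i₀) (*-zeroʳ i₀)) (*-comm E i₀)))
    ; above-others = others }
    where
    open NewtonPolygon p-prime i₀ (ℤ.- + E)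
    weight≡ : ∀ x j {V} → vℚ x ≡ + V → weight x j ≡ + (i₀ * V + E * j) ℤ.- + 0
    weight≡ x j {V} vx≡ = begin
      + i₀ ℤ.* vℚ x ℤ.- ℤ.- + E ℤ.* + j    ≡⟨ cong (λ v → + i₀ ℤ.* v ℤ.- ℤ.- + E ℤ.* + j) vx≡ ⟩
      + i₀ ℤ.* + V ℤ.- ℤ.- + E ℤ.* + j     ≡⟨ neg-neg (+ i₀) (+ V) (+ E) (+ j) ⟩
      + i₀ ℤ.* + V ℤ.+ + E ℤ.* + j         ≡⟨ cong₂ ℤ._+_ (ℤ.pos-* i₀ V) (ℤ.pos-* E j) ⟨
      + (i₀ * V) ℤ.+ + (E * j)             ≡⟨ ℤ.pos-+ (i₀ * V) (E * j) ⟨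
      + (i₀ * V + E * j)                   ≡⟨ ℤ.+-identityʳ _ ⟨
      + (i₀ * V + E * j) ℤ.- + 0           ∎
      where
      open ≡-Reasoning
      neg-neg : ∀ (b v e j : ℤ) → b ℤ.* v ℤ.- ℤ.- e ℤ.* j ≡ b ℤ.* v ℤ.+ e ℤ.* j
      neg-neg = solve-∀
    others : ∀ j → j ≢ 0 → j ≢ i₀ → Above (ℤ.suc (+ (i₀ * E) ℤ.- + 0)) j (f j)
    others j j≢0 j≢i₀ with j ≤? k
    ... | no  j≰k = inj₁ (f-high j (≰⇒> j≰k))
    ... | yes j≤k = inj₂ (f≢0 j j≤k , subst (_ ℤ.≤_) (sym (weight≡ (f j) j (v-others j j≤k j≢i₀)))
                      (diff-≤ (suc (i₀ * E)) 0 (i₀ * E + E * j) 0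
                        (+-monoˡ-≤ 0 (subst (_≤ i₀ * E + E * j) (+-comm (i₀ * E) 1)
                          (+-monoʳ-≤ (i₀ * E) (*-mono-≤ 1≤E (n≢0⇒n>0 j≢0)))))))

module Coefficients (k s : ℕ) (a : ℕ → ℤ) (a≢0 : ∀ j → j ≤ k → a j ≢ 0ℤ)
                    (a-smooth : ∀ j → j ≤ k → ∀ q → Prime q → q ∣ ∣ a j ∣ → q ≤ k) where

  n : ℕ
  n = suc (k + s)

  f : ℕ → ℚ
  f = fPoly n k a

  f-low : ∀ j → j ≤ k → f j ≡ (a j ℤ.* cCoeff n k j) ℚ./ 1
  f-low j j≤k with j ≤? k
  ... | yes _   = refl
  ... | no  j≰k = ⊥-elim (j≰k j≤k)

  f-high : ∀ j → k < j → f j ≡ 0ℚ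
  f-high j k<j with j ≤? k
  ... | yes j≤k = ⊥-elim (<⇒≱ k<j j≤k)
  ... | no  _   = refl

  private
    ∣sgn∣≡1 : ∀ m → ∣ sgn m ∣ ≡ 1
    ∣sgn∣≡1 zero    = refl
    ∣sgn∣≡1 (suc m) = trans (ℤ.∣-i∣≡∣i∣ (sgn m)) (∣sgn∣≡1 m)

    C₂ : ℕ → ℕ
    C₂ j = (n ∸ j ∸ 1) C (k ∸ j)

    n≡ : ∀ j → j ≤ k → n ≡ suc (s + (k ∸ j)) + j
    n≡ j j≤k = cong suc (begin
      k + s              ≡⟨ +-comm k s ⟩
      s + k              ≡⟨ cong (s ℕ.+_) (m∸n+n≡m j≤k) ⟨
      s + (k ∸ j + j)    ≡⟨ +-assoc s (k ∸ j) j ⟨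
      s + (k ∸ j) + j    ∎)
      where open ≡-Reasoning

    n∸j≡ : ∀ j → j ≤ k → n ∸ j ≡ suc (s + (k ∸ j))
    n∸j≡ j j≤k = trans (cong (_∸ j) (n≡ j j≤k)) (m+n∸n≡m _ j)

    ∣c∣≡ : ∀ j → ∣ cCoeff n k j ∣ ≡ (n C j) * C₂ j
    ∣c∣≡ j = trans (ℤ.abs-* (+ ((n C j) * C₂ j)) (sgn (k ∸ j)))
                   (trans (cong ((n C j) * C₂ j ℕ.*_) (∣sgn∣≡1 (k ∸ j))) (*-identityʳ _))

    C₂>0 : ∀ j → j ≤ k → 0 < C₂ j
    C₂>0 j j≤k = subst (λ m → 0 < m C (k ∸ j)) (sym (cong (_∸ 1) (n∸j≡ j j≤k))) (C>0 (m≤n+m (k ∸ j) s))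

    j≤n : ∀ {j} → j ≤ k → j ≤ n
    j≤n j≤k = ≤-trans j≤k (≤-trans (m≤m+n k s) (n≤1+n _))

    c≢0 : ∀ j → j ≤ k → cCoeff n k j ≢ 0ℤ
    c≢0 j j≤k c≡0 = <⇒≢ (*-mono-≤ (C>0 (j≤n j≤k)) (C₂>0 j j≤k))
                        (sym (trans (sym (∣c∣≡ j)) (cong ∣_∣ c≡0)))

    ac≢0 : ∀ j → j ≤ k → a j ℤ.* cCoeff n k j ≢ 0ℤ
    ac≢0 j j≤k = *≢0 (a≢0 j j≤k) (c≢0 j j≤k)

  f≢0 : ∀ j → j ≤ k → f j ≢ 0ℚ
  f≢0 j j≤k = subst (_≢ 0ℚ) (sym (f-low j j≤k)) (/1≢0 (ac≢0 j j≤k))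

  f-degree : HasDegree f k
  f-degree = f≢0 k ≤-refl , f-high

  module AtPrime {q : ℕ} (q-prime : Prime q) (k<q : k < q) where

    open Valuation q-prime
    open BinomialValuation q-prime

    f-valuation : ∀ j → j ≤ k → vℚ (f j) ≡ + (ν (n C j) + ν (C₂ j))
    f-valuation j j≤k = begin
      vℚ (f j)                           ≡⟨ cong vℚ (f-low j j≤k) ⟩
      vℚ ((a j ℤ.* cCoeff n k j) ℚ./ 1)  ≡⟨ vℚ-/1 (ac≢0 j j≤k) ⟩
      + νℤ (a j ℤ.* cCoeff n k j)        ≡⟨ cong +_ (νℤ-* (a≢0 j j≤k) (c≢0 j j≤k)) ⟩
      + (νℤ (a j) + νℤ (cCoeff n k j))   ≡⟨ cong₂ (λ x y → + (x + y)) (ν-p∤ q∤a) (cong ν (∣c∣≡ j)) ⟩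
      + ν ((n C j) * C₂ j)               ≡⟨ cong +_ (ν-* (C>0 (j≤n j≤k)) (C₂>0 j j≤k)) ⟩
      + (ν (n C j) + ν (C₂ j))           ∎
      where
      open ≡-Reasoning
      q∤a : ¬ q ∣ ∣ a j ∣
      q∤a q∣a = <⇒≱ k<q (a-smooth j j≤k q q-prime q∣a)

    ν-window-product : ∀ j → j ≤ k → ν (n C j) + ν (C₂ j) + ν (n ∸ j) ≡ ν (rising s (suc k))
    ν-window-product j j≤k = begin
      ν (n C j) + ν (C₂ j) + ν (n ∸ j)
        ≡⟨ cong (λ m → ν (m C j) + ν (C₂ j) + ν (n ∸ j)) (n≡ j j≤k) ⟩
      ν ((c + j) C j) + ν (C₂ j) + ν (n ∸ j)
        ≡⟨ cong₂ (λ x y → ν ((c + j) C j) + ν (x C r) + ν y) (cong (_∸ 1) (n∸j≡ j j≤k))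
                                                                (n∸j≡ j j≤k) ⟩
      ν ((c + j) C j) + ν ((s + r) C r) + ν c
        ≡⟨ ν-binomials s j r (≤-<-trans j≤k k<q) (≤-<-trans (m∸n≤m k j) k<q) ⟩
      ν (rising s (r + suc j))
        ≡⟨ cong (λ m → ν (rising s m)) (trans (+-suc r j) (cong suc (m∸n+n≡m j≤k))) ⟩
      ν (rising s (suc k))
        ∎
      where
      open ≡-Reasoning
      r = k ∸ j
      c = suc (s + r)

    -- As k < q, the window (s, n] holds at most one multiple t of q,
    -- and f i₀ lacks exactly the factor t = n − i₀ of the window product.
    module Window (i₀ t E : ℕ) (i₀≤k : i₀ ≤ k) (i₀+t≡n : i₀ + t ≡ n)
                  (1≤E : 1 ≤ E) (νt≡E : ν t ≡ E) where

      private
        n≡s+1+k : n ≡ s + suc k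
        n≡s+1+k = trans (cong suc (+-comm k s)) (sym (+-suc s k))

        s<t : s < t
        s<t = ≰⇒> (λ t≤s → <⇒≢ (s≤s (+-mono-≤ i₀≤k t≤s)) i₀+t≡n)

        t≤ : t ≤ s + suc k
        t≤ = subst (t ≤_) (trans i₀+t≡n n≡s+1+k) (m≤n+m t i₀)

        q∣t : q ∣ t
        q∣t = 0<ν⇒∣ (<-≤-trans (s≤s z≤n) s<t) (subst (0 <_) (sym νt≡E) 1≤E)

        ν-rising≡E : ν (rising s (suc k)) ≡ E
        ν-rising≡E = trans (ν-rising-single s (suc k) t s<t t≤
                             (λ x s<x x≤ x≢t → p∤-window k<q q∣t s<t t≤ s<x x≤ x≢t)) νt≡E

        n∸i₀≡t : n ∸ i₀ ≡ t
        n∸i₀≡t = trans (cong (_∸ i₀) (sym i₀+t≡n)) (m+n∸m≡n i₀ t)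

        ν-n∸j≡0 : ∀ j → j ≤ k → j ≢ i₀ → ν (n ∸ j) ≡ 0
        ν-n∸j≡0 j j≤k j≢i₀ = ν-p∤ (p∤-window k<q q∣t s<t t≤ s<n∸j n∸j≤ n∸j≢t)
          where
          s<n∸j : s < n ∸ j
          s<n∸j = subst (s <_) (sym (n∸j≡ j j≤k)) (s≤s (m≤m+n s (k ∸ j)))
          n∸j≤ : n ∸ j ≤ s + suc k
          n∸j≤ = subst (n ∸ j ≤_) n≡s+1+k (m∸n≤m n j)
          n∸j≢t : n ∸ j ≢ t
          n∸j≢t n∸j≡t = j≢i₀ (+-cancelʳ-≡ t j i₀ (begin
            j + t          ≡⟨ cong (j ℕ.+_) n∸j≡t ⟨
            j + (n ∸ j)    ≡⟨ m+[n∸m]≡n (j≤n j≤k) ⟩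
            n              ≡⟨ i₀+t≡n ⟨
            i₀ + t         ∎))
            where open ≡-Reasoning

      v-drop : vℚ (f i₀) ≡ + 0
      v-drop = trans (f-valuation i₀ i₀≤k) (cong +_ (+-cancelʳ-≡ E _ 0 (begin
        ν (n C i₀) + ν (C₂ i₀) + E
          ≡⟨ cong (λ m → ν (n C i₀) + ν (C₂ i₀) + m) (trans (cong ν n∸i₀≡t) νt≡E) ⟨
        ν (n C i₀) + ν (C₂ i₀) + ν (n ∸ i₀)    ≡⟨ ν-window-product i₀ i₀≤k ⟩
        ν (rising s (suc k))                   ≡⟨ ν-rising≡E ⟩
        E                                      ∎)))
        where open ≡-Reasoning

      v-others : ∀ j → j ≤ k → j ≢ i₀ → vℚ (f j) ≡ + E
      v-others j j≤k j≢i₀ = trans (f-valuation j j≤k) (cong +_ (begin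
        ν (n C j) + ν (C₂ j)               ≡⟨ +-identityʳ _ ⟨
        ν (n C j) + ν (C₂ j) + 0           ≡⟨ cong (ν (n C j) + ν (C₂ j) ℕ.+_) (ν-n∸j≡0 j j≤k j≢i₀) ⟨
        ν (n C j) + ν (C₂ j) + ν (n ∸ j)   ≡⟨ ν-window-product j j≤k ⟩
        ν (rising s (suc k))               ≡⟨ ν-rising≡E ⟩
        E                                  ∎))
        where open ≡-Reasoning

      open SingleDrop q-prime f k i₀ E 1≤E f≢0 f-high v-drop v-others public

-- Largest coprime divisors and prime factorisations

∣⇒>0 : ∀ {d N} → 0 < N → d ∣ N → 0 < d
∣⇒>0 {zero}  0<N 0∣N = ⊥-elim (<⇒≢ 0<N (sym (0∣⇒≡0 0∣N)))
∣⇒>0 {suc d} _   _   = s≤s z≤n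

Coprime-* : ∀ {a b M} → Coprime a M → Coprime b M → Coprime (a * b) M
Coprime-* {a} {b} {M} a⊥M b⊥M {i} (i∣ab , i∣M) = b⊥M (coprime-divisor i⊥a i∣ab , i∣M)
  where
  i⊥a : Coprime i a
  i⊥a (j∣i , j∣a) = a⊥M (j∣a , ∣-trans j∣i i∣M)

Coprime-^ : ∀ {p M} r → Prime p → ¬ p ∣ M → Coprime (p ^ r) M
Coprime-^ zero    _       _   (i∣1 , _)   = ∣1⇒≡1 i∣1
Coprime-^ (suc r) p-prime p∤M = Coprime-* p⊥M (Coprime-^ r p-prime p∤M)
  where
  p⊥M : Coprime _ _
  p⊥M (i∣p , i∣M) with prime⇒irreducible p-prime i∣p
  ... | inj₁ i≡1 = i≡1
  ... | inj₂ refl = ⊥-elim (p∤M i∣M)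

largestCoprimeDivisor-∣ : ∀ {d N M x} → IsLargestCoprimeDivisor d N M → 0 < N → x ∣ N → Coprime x M → x ∣ d
largestCoprimeDivisor-∣ {d} {N} {M} {x} (d∣N , d⊥M , largest) 0<N x∣N x⊥M =
  subst (x ∣_) lcm≡d (n∣lcm[m,n] d x)
  where
  lcm∣N : lcm d x ∣ N
  lcm∣N = lcm-least d∣N x∣N
  lcm⊥M : Coprime (lcm d x) M
  lcm⊥M (i∣lcm , i∣M) = Coprime-* d⊥M x⊥M (∣-trans i∣lcm (lcm-least {d} {x} (m∣m*n x) (n∣m*n d)) , i∣M)
  lcm≡d : lcm d x ≡ d
  lcm≡d = ≤-antisym (largest _ lcm∣N lcm⊥M)
                    (∣⇒≤ {{>-nonZero (∣⇒>0 0<N lcm∣N)}} (m∣lcm[m,n] d x))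

≤⇒∣! : ∀ {m k} → 0 < m → m ≤ k → m ∣ k !
≤⇒∣! {suc m} _ m≤k = ∣-trans (m∣m*n (m !)) (m≤n⇒m!∣n! m≤k)

prime∣coprime⇒∤ : ∀ {q d M} → Prime q → q ∣ d → Coprime d M → ¬ q ∣ M
prime∣coprime⇒∤ q-prime q∣d d⊥M q∣M = <⇒≢ (Valuation.1<p q-prime) (sym (d⊥M (q∣d , q∣M)))

prime∤!⇒< : ∀ {q k} → Prime q → ¬ q ∣ k ! → k < q
prime∤!⇒< q-prime q∤k! = ≰⇒> (λ q≤k → q∤k! (≤⇒∣! (<⇒≤ (Valuation.1<p q-prime)) q≤k))

module _ {p : ℕ} (p-prime : Prime p) where

  open Valuation p-prime

  ν-largestCoprimeDivisor : ∀ {d N M} → IsLargestCoprimeDivisor d N M → 0 < N → ¬ p ∣ M → ν N ≡ ν d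
  ν-largestCoprimeDivisor {d} {N} L@(d∣N , _) 0<N p∤M = ≤-antisym
    (^∣⇒≤ν 0<d (largestCoprimeDivisor-∣ L 0<N (≤ν⇒^∣ 0<N ≤-refl) (Coprime-^ (ν N) p-prime p∤M)))
    (^∣⇒≤ν 0<N (∣-trans (≤ν⇒^∣ 0<d ≤-refl) d∣N))
    where
    0<d : 0 < d
    0<d = ∣⇒>0 0<N d∣N

  ∣^⇒≡ : ∀ {q} r → Prime q → p ∣ q ^ r → p ≡ q
  ∣^⇒≡ zero    _       p∣1 = ⊥-elim (p∤1 p∣1)
  ∣^⇒≡ (suc r) q-prime p∣q^r with euclidsLemma _ _ p-prime p∣q^r
  ... | inj₂ p∣q^r′ = ∣^⇒≡ r q-prime p∣q^r′
  ... | inj₁ p∣q with prime⇒irreducible q-prime p∣q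
  ...   | inj₁ refl = ⊥-elim (p∤1 ∣-refl)
  ...   | inj₂ p≡q  = p≡q

  p∤factorProduct : ∀ {ps} → All (Prime ∘ proj₁) ps → All ((p ≢_) ∘ proj₁) ps → ¬ p ∣ factorProduct ps
  p∤factorProduct {[]}          []             []             = p∤1
  p∤factorProduct {(q , r) ∷ _} (q-prime ∷ ps) (p≢q ∷ p≢ps) p∣ with euclidsLemma (q ^ r) _ p-prime p∣
  ... | inj₁ p∣q^r = p≢q (∣^⇒≡ r q-prime p∣q^r)
  ... | inj₂ p∣rest = p∤factorProduct ps p≢ps p∣rest

  -- Two factors less than p apart cannot both be divisible by p.
  ν-*-apart : ∀ {x c E} → 0 < x → 0 < c → c < p → ν (x * (x + c)) ≡ E → ν x ≡ E ⊎ ν (x + c) ≡ E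
  ν-*-apart {x} {c} {E} 0<x 0<c c<p ν≡E = cases (ν x ≟ 0) (ν (x + c) ≟ 0)
    where
    0<x+c : 0 < x + c
    0<x+c = <-≤-trans 0<x (m≤m+n x c)
    νx+νx+c≡E : ν x + ν (x + c) ≡ E
    νx+νx+c≡E = trans (sym (ν-* 0<x 0<x+c)) ν≡E
    cases : Dec (ν x ≡ 0) → Dec (ν (x + c) ≡ 0) → ν x ≡ E ⊎ ν (x + c) ≡ E
    cases (yes νx≡0) _            = inj₂ (trans (cong (_+ ν (x + c)) (sym νx≡0)) νx+νx+c≡E)
    cases (no _)     (yes νx+c≡0) =
      inj₁ (trans (sym (trans (cong (ν x ℕ.+_) νx+c≡0) (+-identityʳ (ν x)))) νx+νx+c≡E)
    cases (no νx≢0)  (no νx+c≢0)  = ⊥-elim (<⇒≱ c<p (∣m∣m+n⇒≤n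
      (0<ν⇒∣ 0<x (n≢0⇒n>0 νx≢0)) (0<ν⇒∣ 0<x+c (n≢0⇒n>0 νx+c≢0)) 0<c))

factorProduct>0 : ∀ {ps} → All (Prime ∘ proj₁) ps → 0 < factorProduct ps
factorProduct>0 {[]}          []             = s≤s z≤n
factorProduct>0 {(q , r) ∷ _} (q-prime ∷ ps) =
  *-mono-≤ (m^n>0 q {{prime⇒nonZero q-prime}} r) (factorProduct>0 ps)

HasExponent : ℕ → ℕ × ℕ → Set
HasExponent N (q , r) = (q-prime : Prime q) → Valuation.ν q-prime N ≡ r

factorProduct-ν : ∀ ps → All (Prime ∘ proj₁) ps → Unique (map proj₁ ps) → All (HasExponent (factorProduct ps)) ps
factorProduct-ν []             []             []             = []
factorProduct-ν ((q , r) ∷ ps) (q-prime ∷ primes) (q∉ps ∷ unique) =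
  ν-head ∷ All.zipWith ν-tail (factorProduct-ν ps primes unique , All.map⁻ q∉ps)
  where
  ν-head : HasExponent (q ^ r * factorProduct ps) (q , r)
  ν-head q-prime′ = Valuation.ν-unique q-prime′ refl (p∤factorProduct q-prime′ primes (All.map⁻ q∉ps))

  ν-tail : ∀ {q′r′} → HasExponent (factorProduct ps) q′r′ × q ≢ proj₁ q′r′ →
           HasExponent (q ^ r * factorProduct ps) q′r′
  ν-tail {q′ , r′} (ν-rest , q≢q′) q′-prime = begin
    ν (q ^ r * factorProduct ps)       ≡⟨ ν-* (m^n>0 q {{prime⇒nonZero q-prime}} r) (factorProduct>0 primes) ⟩
    ν (q ^ r) + ν (factorProduct ps)   ≡⟨ cong₂ _+_ (ν-p∤ q′∤q^r) (ν-rest q′-prime) ⟩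
    r′                                 ∎
    where
    open ≡-Reasoning
    open Valuation q′-prime
    q′∤q^r : ¬ q′ ∣ q ^ r
    q′∤q^r q′∣q^r = q≢q′ (sym (∣^⇒≡ q′-prime r q-prime q′∣q^r))

∣*-foldr-gcd : ∀ {k d} xs → All (λ x → k ∣ d * x) xs → k ∣ d * foldr gcd k xs
∣*-foldr-gcd {k} {d} []       []           = ∣n⇒∣m*n d ∣-refl
∣*-foldr-gcd {k} {d} (x ∷ xs) (k∣dx ∷ k∣dxs) =
  subst (k ∣_) (sym (c*gcd[m,n]≡gcd[cm,cn] d x _)) (gcd-greatest k∣dx (∣*-foldr-gcd {k} {d} xs k∣dxs))

∣*2⇒*2≡ : ∀ {k d} → k ∣ d * 2 → 0 < d → d < k → d * 2 ≡ k
∣*2⇒*2≡ {k} {d} (divides zero          d*2≡0)    0<d _   =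
  ⊥-elim (<⇒≢ (*-mono-≤ 0<d (s≤s z≤n)) (sym d*2≡0))
∣*2⇒*2≡ {k} {d} (divides (suc zero)    d*2≡1*k)  _   _   = trans d*2≡1*k (+-identityʳ k)
∣*2⇒*2≡ {k} {d} (divides (suc (suc m)) d*2≡m+2*k) _  d<k = ⊥-elim (<⇒≱ (*-monoˡ-< 2 d<k) (begin
  k * 2                ≡⟨ *-comm k 2 ⟩
  2 * k                ≤⟨ *-monoˡ-≤ k {2} {suc (suc m)} (s≤s (s≤s z≤n)) ⟩
  suc (suc m) * k      ≡⟨ d*2≡m+2*k ⟨
  d * 2                ∎))
  where open ≤-Reasoning

∣*-consecutive : ∀ {β E d} → 0 < d → β ∣ E * d → β ∣ E * (d ∸ 1) → β ∣ E
∣*-consecutive {β} {E} {suc d} _ β∣E*[1+d] β∣E*d =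
  ∣m+n∣m⇒∣n (subst (β ∣_) (trans (*-suc E d) (+-comm E (E * d))) β∣E*[1+d]) β∣E*d

+≡1 : ∀ {x y} → x + y ≡ 1 → (x ≡ 0 × y ≡ 1) ⊎ (x ≡ 1 × y ≡ 0)
+≡1 {zero}        refl = inj₁ (refl , refl)
+≡1 {suc zero}    {zero} refl = inj₂ (refl , refl)

+≡+-bounded : ∀ {x y d e} → x ≤ d → y ≤ e → x + y ≡ d + e → x ≡ d × y ≡ e
+≡+-bounded {x} {y} {d} {e} x≤d y≤e x+y≡d+e with m≤n⇒m<n∨m≡n x≤d
... | inj₁ x<d = ⊥-elim (<⇒≢ (+-mono-<-≤ x<d y≤e) x+y≡d+e)
... | inj₂ refl = refl , +-cancelˡ-≡ x y e x+y≡d+e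

+≡2d-1 : ∀ {x y d} → x ≤ d → y ≤ d → suc (x + y) ≡ d + d →
         (x ≡ d × y ≡ d ∸ 1) ⊎ (y ≡ d × x ≡ d ∸ 1)
+≡2d-1 {x} {y} {d} x≤d y≤d eq with m≤n⇒m<n∨m≡n x≤d
... | inj₂ refl = inj₁ (refl , cong (_∸ 1) (+-cancelˡ-≡ x (suc y) x (trans (+-suc x y) eq)))
... | inj₁ x<d  = inj₂ (proj₁ ends , cong (_∸ 1) (proj₂ ends))
  where
  ends = +≡+-bounded y≤d x<d (trans (+-comm y (suc x)) eq)

module Factorisation (k s : ℕ) (3≤k : 3 ≤ k) (a : ℕ → ℤ) (a≢0 : ∀ j → j ≤ k → a j ≢ 0ℤ)
                     (a-smooth : ∀ j → j ≤ k → ∀ q → Prime q → q ∣ ∣ a j ∣ → q ≤ k)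
                     (g h : ℕ → ℚ) (d d′ : ℕ) (deg-g : HasDegree g d) (deg-h : HasDegree h d′)
                     (f≡gh : ∀ m → fPoly (suc (k + s)) k a m ≡ polyMulCoeff g h m) where

  open Coefficients k s a a≢0 a-smooth

  d+d′≡k : d + d′ ≡ k
  d+d′≡k = Degree.degree-* deg-g deg-h f-degree f≡gh

  private
    0<k : 0 < k
    0<k = ≤-trans (s≤s z≤n) 3≤k

    edge-split : ∀ {q} (q-prime : Prime q) {β α L H} → NewtonPolygon.ExactSupport q-prime β α f L H →
                 NewtonPolygon.EdgeSplit q-prime β α d d′ L H
    edge-split q-prime = NewtonPolygon.edgeSplit q-prime _ _ deg-g deg-h f≡gh

    edge[0,k]⇒k∣ : ∀ {q} (q-prime : Prime q) {α} →
                   NewtonPolygon.ExactSupport q-prime k α f 0 k → k ∣ ∣ α ∣ * d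
    edge[0,k]⇒k∣ q-prime {α} E = subst₂ (λ x y → k ∣ ∣ α ∣ * (x ∸ y)) Hg≡d Lg≡0 β∣g
      where
      open NewtonPolygon.EdgeSplit (edge-split q-prime E)
      Lg≡0 : Lg ≡ 0
      Lg≡0 = m+n≡0⇒m≡0 Lg Lg+Lh≡L
      Hg≡d : Hg ≡ d
      Hg≡d = proj₁ (+≡+-bounded Hg≤d Hh≤e (trans Hg+Hh≡H (sym d+d′≡k)))

    N₁>0 : 0 < n * (n ∸ k)
    N₁>0 = *-mono-≤ {1} {n} (s≤s z≤n) (m<n⇒0<n∸m (s≤s (m≤m+n k s)))

    N₂>0 : 0 < (n ∸ 1) * (n ∸ k + 1)
    N₂>0 = *-mono-≤ (≤-trans 0<k (m≤m+n k s)) (m≤n+m 1 (n ∸ k))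

    n∸k≡1+s : n ∸ k ≡ suc s
    n∸k≡1+s = trans (cong (_∸ k) (sym (+-suc k s))) (m+n∸m≡n k (suc s))

    1+[k∸1]≡k : suc (k ∸ 1) ≡ k
    1+[k∸1]≡k = m+[n∸m]≡n 0<k

    2+s+[k∸2]≡k+s : suc (suc s) + (k ∸ 2) ≡ k + s
    2+s+[k∸2]≡k+s = begin
      suc (suc s) + (k ∸ 2)    ≡⟨ cong (2 ℕ.+_) (+-comm s (k ∸ 2)) ⟩
      2 + ((k ∸ 2) + s)        ≡⟨ +-assoc 2 (k ∸ 2) s ⟨
      2 + (k ∸ 2) + s          ≡⟨ cong (_+ s) (m+[n∸m]≡n (≤-trans (s≤s (s≤s z≤n)) 3≤k)) ⟩
      k + s                    ∎
      where open ≡-Reasoning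

  k∣d*E : ∀ {q} (q-prime : Prime q) → k < q → ∀ {E} → 1 ≤ E →
          Valuation.ν q-prime (n * (n ∸ k)) ≡ E → k ∣ d * E
  k∣d*E q-prime k<q {E} 1≤E ν≡E with ν-*-apart q-prime (s≤s z≤n) 0<k k<q (trans (cong ν N≡) ν≡E)
    where
    open Valuation q-prime
    N≡ : suc s * (suc s + k) ≡ n * (n ∸ k)
    N≡ = trans (*-comm (suc s) _) (cong₂ _*_ (cong suc (+-comm s k)) (sym n∸k≡1+s))
  ... | inj₁ ν[1+s]≡E = subst (k ∣_) (*-comm E d) (subst (λ x → k ∣ x * d) (ℤ.∣-i∣≡∣i∣ (+ E))
    (edge[0,k]⇒k∣ q-prime (AtPrime.Window.edge-left q-prime k<q k (suc s) E ≤-refl (+-suc k s) 1≤E ν[1+s]≡E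
                                                     0<k ≤-refl)))
  ... | inj₂ νn≡E = subst (k ∣_) (*-comm E d)
    (edge[0,k]⇒k∣ q-prime (AtPrime.Window.edge-right q-prime k<q 0 n E z≤n refl 1≤E
      (trans (cong (Valuation.ν q-prime) (cong suc (+-comm k s))) νn≡E) 0<k))

  module _ (d*2≡k : d * 2 ≡ k) where

    private
      d+d≡k : d + d ≡ k
      d+d≡k = trans (cong (d ℕ.+_) (sym (+-identityʳ d))) (trans (*-comm 2 d) d*2≡k)

      d′≡d : d′ ≡ d
      d′≡d = +-cancelˡ-≡ d d′ d (trans d+d′≡k (sym d+d≡k))

      0<d : 0 < d
      0<d = n≢0⇒n>0 (λ { refl → <⇒≢ 0<k d*2≡k })

      ∣-pair : ∀ {β E x y} → β ∣ E * x → β ∣ E * y →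
               (x ≡ d × y ≡ d ∸ 1) ⊎ (y ≡ d × x ≡ d ∸ 1) → β ∣ E
      ∣-pair β∣x β∣y (inj₁ (refl , refl)) = ∣*-consecutive 0<d β∣x β∣y
      ∣-pair β∣x β∣y (inj₂ (refl , refl)) = ∣*-consecutive 0<d β∣y β∣x

      edge[0,k-1]⇒k-1∣ : ∀ {q} (q-prime : Prime q) {α} →
                         NewtonPolygon.ExactSupport q-prime (k ∸ 1) α f 0 (k ∸ 1) → (k ∸ 1) ∣ ∣ α ∣
      edge[0,k-1]⇒k-1∣ q-prime {α} E =
        ∣-pair (subst (λ y → (k ∸ 1) ∣ ∣ α ∣ * (Hg ∸ y)) (m+n≡0⇒m≡0 Lg Lg+Lh≡L) β∣g)
               (subst (λ y → (k ∸ 1) ∣ ∣ α ∣ * (Hh ∸ y)) (m+n≡0⇒n≡0 Lg Lg+Lh≡L) β∣h)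
               (+≡2d-1 Hg≤d (subst (Hh ≤_) d′≡d Hh≤e)
                       (trans (cong suc Hg+Hh≡H) (trans 1+[k∸1]≡k (sym d+d≡k))))
        where open NewtonPolygon.EdgeSplit (edge-split q-prime E)

      edge[1,k]⇒k-1∣ : ∀ {q} (q-prime : Prime q) {α} →
                       NewtonPolygon.ExactSupport q-prime (k ∸ 1) α f 1 k → (k ∸ 1) ∣ ∣ α ∣
      edge[1,k]⇒k-1∣ q-prime {α} E =
        ∣-pair (subst (λ x → (k ∸ 1) ∣ ∣ α ∣ * (x ∸ Lg)) (proj₁ ends) β∣g)
               (subst (λ x → (k ∸ 1) ∣ ∣ α ∣ * (x ∸ Lh)) (trans (proj₂ ends) d′≡d) β∣h)
               (Sum.map (Product.map (cong (d ∸_)) (cong (d ∸_)))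
                        (Product.map (cong (d ∸_)) (cong (d ∸_)) ∘ Product.swap) (+≡1 {Lg} {Lh} Lg+Lh≡L))
        where
        open NewtonPolygon.EdgeSplit (edge-split q-prime E)
        ends = +≡+-bounded Hg≤d Hh≤e (trans Hg+Hh≡H (sym d+d′≡k))

    k-1∣E : ∀ {q} (q-prime : Prime q) → k < q → ∀ {E} → 1 ≤ E →
            Valuation.ν q-prime ((n ∸ 1) * (n ∸ k + 1)) ≡ E → (k ∸ 1) ∣ E
    k-1∣E q-prime k<q {E} 1≤E ν≡E
      with ν-*-apart q-prime {suc (suc s)} {k ∸ 2} (s≤s z≤n) (m<n⇒0<n∸m 3≤k) (≤-<-trans (m∸n≤m k 2) k<q)
                     (trans (cong (Valuation.ν q-prime) N≡) ν≡E)
      where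
      N≡ : suc (suc s) * (suc (suc s) + (k ∸ 2)) ≡ (n ∸ 1) * (n ∸ k + 1)
      N≡ = trans (*-comm (suc (suc s)) _)
                 (cong₂ _*_ 2+s+[k∸2]≡k+s (sym (trans (cong (_+ 1) n∸k≡1+s) (+-comm (suc s) 1))))
    ... | inj₁ ν[2+s]≡E = subst ((k ∸ 1) ∣_) (ℤ.∣-i∣≡∣i∣ (+ E))
      (edge[0,k-1]⇒k-1∣ q-prime (AtPrime.Window.edge-left q-prime k<q (k ∸ 1) (suc (suc s)) E (m∸n≤m k 1)
        k∸1+2+s≡n 1≤E ν[2+s]≡E (m<n⇒0<n∸m (≤-trans (s≤s (s≤s z≤n)) 3≤k)) (m∸n≤m k 1)))
      where
      k∸1+2+s≡n : k ∸ 1 + suc (suc s) ≡ n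
      k∸1+2+s≡n = trans (+-suc (k ∸ 1) (suc s)) (cong suc (trans (+-suc (k ∸ 1) s) (cong (_+ s) 1+[k∸1]≡k)))
    ... | inj₂ ν[k+s]≡E = edge[1,k]⇒k-1∣ q-prime (AtPrime.Window.edge-right q-prime k<q 1 (k + s) E 0<k refl 1≤E
      (trans (cong (Valuation.ν q-prime) (sym 2+s+[k∸2]≡k+s)) ν[k+s]≡E) (≤-trans (s≤s (s≤s z≤n)) 3≤k))

  k∣d*ν : ∀ {n′} → IsLargestCoprimeDivisor n′ (n * (n ∸ k)) (k !) → ∀ {q} (q-prime : Prime q) →
          0 < Valuation.ν q-prime n′ → k ∣ d * Valuation.ν q-prime n′
  k∣d*ν n′-largest@(n′∣N₁ , n′⊥k! , _) q-prime 0<ν =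
    k∣d*E q-prime (prime∤!⇒< q-prime q∤k!) 0<ν (ν-largestCoprimeDivisor q-prime n′-largest N₁>0 q∤k!)
    where
    q∤k! = prime∣coprime⇒∤ q-prime (Valuation.0<ν⇒∣ q-prime (∣⇒>0 N₁>0 n′∣N₁) 0<ν) n′⊥k!

  k-1∣ν : d * 2 ≡ k → ∀ {n″} → IsLargestCoprimeDivisor n″ ((n ∸ 1) * (n ∸ k + 1)) (k !) →
          ∀ {q} (q-prime : Prime q) → k < q → 0 < Valuation.ν q-prime n″ → (k ∸ 1) ∣ Valuation.ν q-prime n″
  k-1∣ν d*2≡k n″-largest q-prime k<q 0<ν = k-1∣E d*2≡k q-prime k<q 0<ν
    (ν-largestCoprimeDivisor q-prime n″-largest N₂>0 (BinomialValuation.p∤! q-prime k<q))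

lemma3 : (n k : ℕ) → 3 ≤ k → k ≤ n ∸ 1 → (a : ℕ → ℤ) →
  (∀ j → j ≤ k → a j ≢ Data.Integer.0ℤ) →
  (∀ j → j ≤ k → ∀ q → Prime q → q ∣ ∣ a j ∣ → q ≤ k) →
  (n' : ℕ) → IsLargestCoprimeDivisor n' (n * (n ∸ k)) (k !) →
  (ps : List (ℕ × ℕ)) → All (λ pe → Prime (proj₁ pe)) ps →
  Unique (map proj₁ ps) → All (λ pe → 1 ≤ proj₂ pe) ps →
  n' ≡ factorProduct ps → gcdWithExps k ps ≡ 2 →
  (n'' : ℕ) → IsLargestCoprimeDivisor n'' ((n ∸ 1) * (n ∸ k + 1)) (k !) →
  (p e : ℕ) → Prime p → k < p → 1 ≤ e → HasValuation p n'' e →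
  ReducibleOverℚ (fPoly n k a) →
  (k ∸ 1) ∣ e
lemma3 zero _ (s≤s _) ()
lemma3 (suc n₀) k 3≤k k≤n₀ a a≢0 a-smooth n' n'-largest ps primes unique exponents≥1 n'≡ gcd≡2
       n'' n''-largest p e p-prime k<p 1≤e νn''≡e (g , h , d , d′ , 1≤d , 1≤d′ , deg-g , deg-h , f≡gh)
  with m≤n⇒∃[o]m+o≡n k≤n₀
... | s , refl = subst ((k ∸ 1) ∣_) ν[n″]≡e
                   (k-1∣ν d*2≡k n''-largest p-prime k<p (subst (0 <_) (sym ν[n″]≡e) 1≤e))
  where
  open Factorisation k s 3≤k a a≢0 a-smooth g h d d′ deg-g deg-h f≡gh
  open Valuation using (ν)

  k∣d*exponent : ∀ {q r} → Prime q → HasExponent (factorProduct ps) (q , r) → 1 ≤ r → k ∣ d * r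
  k∣d*exponent q-prime νq≡r 1≤r =
    subst (λ x → k ∣ d * x) ν[n′]≡r (k∣d*ν n'-largest q-prime (subst (0 <_) (sym ν[n′]≡r) 1≤r))
    where ν[n′]≡r = trans (cong (ν q-prime) n'≡) (νq≡r q-prime)

  k∣d*exponents : All (λ qr → k ∣ d * proj₂ qr) ps
  k∣d*exponents = All.zipWith (λ { (q-prime , νq≡r , 1≤r) → k∣d*exponent q-prime νq≡r 1≤r })
    (primes , All.zipWith (λ x → x) (factorProduct-ν ps primes unique , exponents≥1))

  d*2≡k : d * 2 ≡ k
  d*2≡k = ∣*2⇒*2≡ (subst (λ x → k ∣ d * x) gcd≡2 (∣*-foldr-gcd {k} {d} (map proj₂ ps) (All.map⁺ k∣d*exponents)))
                  1≤d (subst (d <_) d+d′≡k (m<m+n d 1≤d′))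

  ν[n″]≡e : ν p-prime n'' ≡ e
  ν[n″]≡e = Valuation.hasValuation⇒ν p-prime νn''≡e
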